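{- Let $F$ be a fatgraph. Then for all $i,j$, \[ \widetilde H^i_j(\widetilde{\mathcal C}(F))\cong\bigoplus_{p+q=j}\Big(\big(\widehat H^i_p(\widehat{\mathcal C}(F))\otimes\overline\Delta(R^{\otimes(i-1)})_q\big)\oplus\big(Z^i_p(\widehat{\mathcal C}(F))\otimes R^{\otimes i}_q/\overline\Delta(R^{\otimes(i-1)})_q\big)\Big), \] where $\widetilde H$ is the homology of $\widetilde{\mathcal C}(F)$, $\widehat H$ is the homology of $\widehat{\mathcal C}(F)$, $Z^i_p(\widehat{\mathcal C}(F))=\ker(\widehat d^i)_p$ are its cycles, $\overline\Delta=\overline\Delta_{i-1}$, and $M_p$ denotes the degree-$p$ part of a graded module $M$. Moreover $\widetilde H^{i+e(F)}_j(\widetilde{\mathcal C}(F))=H^i_j(\mathcal C(F))$.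
   Context: A fatgraph is a finite graph (loops and multiple edges allowed) with a cyclic order of half-edges at each vertex; it determines a compact orientable surface with boundary. For a fatgraph $H$: $v(H),e(H)$ numbers of vertices and edges, $p(H)$ number of boundary components, $g(H)$ genus. A state is a spanning fatsubgraph $H=(V(F),W)$, $W\subseteq E(F)$, with height $h(H)=e(F)-e(H)$. $M\{l\}_m=M_{m-l}$; height shift $(\mathcal C[s])^i=\mathcal C^{i-s}$. $V$: free graded $\mathbb Z$-module on $v_\pm$ in degrees $\pm1$; $R$: free graded on $x_{ -2},x_0$ in degrees $-2,0$; $V^{\otimes0}=R^{\otimes0}=\mathbb Z$. Maps: $\widetilde m':V\otimes V\to V$, $v_+\otimes v_+\mapsto v_+$, $v_\pm\otimes v_\mp\mapsto v_-$, $v_-\otimes v_-\mapsto0$; $\widetilde\Delta':V\to V\otimes V$, $v_+\mapsto v_+\otimes v_-+v_-\otimes v_+$, $v_-\mapsto v_-\otimes v_-$; $\widehat m_g:V^{\otimes2g}\to V^{\otimes2(g-1)}$ sends a basis tensor to the sum of all basis tensors of the same degree; $\overline\Delta_h:R^{\otimes h}\to R^{\otimes(h+1)}$, $1\mapsto x_0$ for $h=0$ and for $h\ge1$ acting on the last factor by $x_0\mapsto x_0\otimes x_0$, $x_{ -2}\mapsto x_{ -2}\otimes x_0+x_0\otimes x_{ -2}$. Number edges $1,\dots,n$, encode states by $\alpha\in\{0,1\}^n$ ($\alpha_i=0$ iff edge $i$ present). For edge $j$ in $H$, $H'=H-e_j$ merges two boundary components or splits one, and $g(H')\in\{g(H),g(H)-1\}$.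 Restricted Bollobás–Riordan complex $\widehat{\mathcal C}(F)$: state $H$ gets $B(H)=V^{\otimes v(H)}\otimes V^{\otimes p(H)}\otimes V^{\otimes2g(H)}\{h(H)\}$, per-edge map $B(H)\to B(H')$ equal to $(-1)^{\sum_{i<j}\alpha_i}$ times the tensor of the identity on $V^{\otimes v}$, $\widetilde m'$ (merge) or $\widetilde\Delta'$ (split) on affected boundary factors and identity elsewhere, and identity or $\widehat m_g$ on $V^{\otimes 2g}$ (genus unchanged or dropping); $\widehat{\mathcal C}^h=\bigoplus_{h(H)=h}B(H)$ with differential $\widehat d^h$ the sum of per-edge maps. Chromatic complex $\widetilde{\mathcal C}(F)$: same but with $A(H)=V^{\otimes v(H)}\otimes V^{\otimes p(H)}\otimes V^{\otimes2g(H)}\otimes R^{\otimes h(H)}\{h(H)\}$ and per-edge maps additionally tensored with $\overline\Delta_{h(H)}$ on $R^{\otimes h(H)}$ (so $\widetilde{\mathcal C}^i=\widehat{\mathcal C}^i\otimes R^{\otimes i}$ with differential $\widehat d^i\otimes\overline\Delta_i$). $\mathcal C(F)=\widetilde{\mathcal C}(F)[-e(F)]$ and $H(\mathcal C(F))$ is its homology. -}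

module Defs where

open import Data.Bool using (Bool; true; false; if_then_else_; _∧_; _∨_; not)
open import Data.Nat as ℕ using (ℕ; zero; suc; _∸_; ⌊_/2⌋; _≡ᵇ_; _<ᵇ_; _⊓_)
open import Data.Integer as ℤ using (ℤ; +_; 0ℤ; 1ℤ; _+_; _-_; _*_; -_)
import Data.Integer.Properties as ℤP
open import Data.Fin using (Fin; toℕ)
open import Data.Vec as Vec using (Vec; []; _∷_; lookup; _[_]≔_; toList)
open import Data.List as List using (List; []; _∷_; _++_; length; foldr; allFin; upTo; concatMap; filterᵇ; map)
open import Data.Product using (Σ; _×_; _,_; proj₁; proj₂)
open import Data.Sum using (_⊎_; inj₁; inj₂)
open import Data.Unit using (⊤; tt)
open import Relation.Binary.PropositionalEquality using (_≡_; refl; cong; cong₂; sym; trans)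

allB : {A : Set} → (A → Bool) → List A → Bool
allB P = foldr (λ x r → P x ∧ r) true

anyB : {A : Set} → (A → Bool) → List A → Bool
anyB P = foldr (λ x r → P x ∨ r) false

sumℤ : List ℤ → ℤ
sumℤ = foldr _+_ 0ℤ

boolℤ : Bool → ℤ
boolℤ true  = 1ℤ
boolℤ false = 0ℤ

eqB : Bool → Bool → Bool
eqB true  true  = true
eqB false false = true
eqB _     _     = false

eqL : List Bool → List Bool → Bool
eqL []       []       = true
eqL (x ∷ xs) (y ∷ ys) = eqB x y ∧ eqL xs ys
eqL _        _        = false

-- all basis tensors of V^{⊗k} (or R^{⊗k}), encoded as Boolean vectors
allVecs : (k : ℕ) → List (Vec Bool k)
allVecs zero    = [] ∷ []
allVecs (suc k) = concatMap (λ v → (true ∷ v) ∷ (false ∷ v) ∷ []) (allVecs k)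

app : {A B : Set} → List A → (A → B → ℤ) → (A → ℤ) → B → ℤ
app []      c f t = 0ℤ
app (s ∷ L) c f t = c s t * f s + app L c f t

Supp : {B : Set} → (B → Set) → (B → ℤ) → Set
Supp P f = ∀ b → f b ≡ 0ℤ ⊎ P b

supp-+ : {B : Set} {P : B → Set} {f g : B → ℤ} → Supp P f → Supp P g → Supp P (λ b → f b + g b)
supp-+ sf sg b with sf b | sg b
... | inj₂ p | _ = inj₂ p
... | inj₁ _ | inj₂ p = inj₂ p
... | inj₁ e | inj₁ e' = inj₁ (trans (cong₂ _+_ e e') refl)

supp-0 : {B : Set} {P : B → Set} → Supp P (λ (b : B) → 0ℤ)
supp-0 b = inj₁ refl

supp-neg : {B : Set} {P : B → Set} {f : B → ℤ} → Supp P f → Supp P (λ b → - f b)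
supp-neg sf b with sf b
... | inj₂ p = inj₂ p
... | inj₁ e = inj₁ (cong -_ e)

interchange : ∀ a b c d → (a + b) + (c + d) ≡ (a + c) + (b + d)
interchange a b c d =
  trans (ℤP.+-assoc a b (c + d))
  (trans (cong (λ z → a + z) (trans (sym (ℤP.+-assoc b c d)) (trans (cong (_+ d) (ℤP.+-comm b c)) (ℤP.+-assoc c b d))))
  (sym (ℤP.+-assoc a c (b + d))))

app-+ : {A B : Set} (L : List A) (c : A → B → ℤ) (f g : A → ℤ) (t : B) →
        app L c (λ s → f s + g s) t ≡ app L c f t + app L c g t
app-+ []      c f g t = refl
app-+ (s ∷ L) c f g t =
  trans (cong₂ _+_ (ℤP.*-distribˡ-+ (c s t) (f s) (g s)) (app-+ L c f g t))
        (interchange (c s t * f s) (c s t * g s) (app L c f t) (app L c g t))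

app-0 : {A B : Set} (L : List A) (c : A → B → ℤ) (t : B) → app L c (λ _ → 0ℤ) t ≡ 0ℤ
app-0 []      c t = refl
app-0 (s ∷ L) c t = trans (cong₂ _+_ (ℤP.*-zeroʳ (c s t)) (app-0 L c t)) refl

app-neg : {A B : Set} (L : List A) (c : A → B → ℤ) (f : A → ℤ) (t : B) →
          app L c (λ s → - f s) t ≡ - app L c f t
app-neg []      c f t = refl
app-neg (s ∷ L) c f t =
  trans (cong₂ _+_ (sym (ℤP.neg-distribʳ-* (c s t) (f s))) (app-neg L c f t))
        (sym (ℤP.neg-distrib-+ (c s t * f s) (app L c f t)))

record Ab : Set₁ where
  field
    C   : Set
    _≈_ : C → C → Set
    _⊕_ : C → C → C
    0#  : C
    ⊝_  : C → C

record _≅_ (A B : Ab) : Set where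
  private
    module A = Ab A
    module B = Ab B
  field
    to       : A.C → B.C
    from     : B.C → A.C
    to-cong  : ∀ {x y} → x A.≈ y → to x B.≈ to y
    from-cong : ∀ {x y} → x B.≈ y → from x A.≈ from y
    to-from  : ∀ y → to (from y) B.≈ y
    from-to  : ∀ x → from (to x) A.≈ x
    to-hom   : ∀ x y → to (x A.⊕ y) B.≈ (to x B.⊕ to y)

ZeroAb : Ab
ZeroAb = record { C = ⊤ ; _≈_ = λ _ _ → ⊤ ; _⊕_ = λ _ _ → tt ; 0# = tt ; ⊝_ = λ _ → tt }

_⊞_ : Ab → Ab → Ab
A ⊞ B = record
  { C = Ab.C A × Ab.C B
  ; _≈_ = λ x y → Ab._≈_ A (proj₁ x) (proj₁ y) × Ab._≈_ B (proj₂ x) (proj₂ y)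
  ; _⊕_ = λ x y → Ab._⊕_ A (proj₁ x) (proj₁ y) , Ab._⊕_ B (proj₂ x) (proj₂ y)
  ; 0# = Ab.0# A , Ab.0# B
  ; ⊝_ = λ x → Ab.⊝_ A (proj₁ x) , Ab.⊝_ B (proj₂ x) }

⨁ : {I : Set} → List I → (I → Ab) → Ab
⨁ []       G = ZeroAb
⨁ (i ∷ is) G = G i ⊞ ⨁ is G

-- tensor product over ℤ: formal sums of pairs modulo the relations
-- generated by commutativity of formal addition, bilinearity, zero and
-- compatibility with the equalities of the factors.
module Tensor (A B : Ab) where
  private
    module A = Ab A
    module B = Ab B
  T : Set
  T = List (A.C × B.C)

  data _∼_ : T → T → Set where
    t-refl  : ∀ {x} → x ∼ x
    t-sym   : ∀ {x y} → x ∼ y → y ∼ x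
    t-trans : ∀ {x y z} → x ∼ y → y ∼ z → x ∼ z
    t-++    : ∀ {x x' y y'} → x ∼ x' → y ∼ y' → (x ++ y) ∼ (x' ++ y')
    t-swap  : ∀ x y → (x ++ y) ∼ (y ++ x)
    t-congˡ : ∀ {a a' b} → a A.≈ a' → ((a , b) ∷ []) ∼ ((a' , b) ∷ [])
    t-congʳ : ∀ {a b b'} → b B.≈ b' → ((a , b) ∷ []) ∼ ((a , b') ∷ [])
    t-linˡ  : ∀ a a' b → ((a A.⊕ a' , b) ∷ []) ∼ ((a , b) ∷ (a' , b) ∷ [])
    t-linʳ  : ∀ a b b' → ((a , b B.⊕ b') ∷ []) ∼ ((a , b) ∷ (a , b') ∷ [])
    t-zeroˡ : ∀ b → ((A.0# , b) ∷ []) ∼ []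
    t-zeroʳ : ∀ a → ((a , B.0#) ∷ []) ∼ []

_⊗_ : Ab → Ab → Ab
A ⊗ B = record
  { C = Tensor.T A B
  ; _≈_ = Tensor._∼_ A B
  ; _⊕_ = _++_
  ; 0# = []
  ; ⊝_ = map (λ p → Ab.⊝_ A (proj₁ p) , proj₂ p) }

record Cx : Set₁ where
  field
    B    : Set
    enum : List B
    hgt  : B → ℤ           -- homological (height) degree i
    deg  : B → ℤ           -- internal (quantum) degree j
    coef : B → B → ℤ       -- coef s t = coefficient of t in d(s)

module _ (X : Cx) where
  open Cx X

  d : (B → ℤ) → B → ℤ
  d = app enum coef

  InDeg : ℤ → ℤ → B → Set
  InDeg i j b = hgt b ≡ i × deg b ≡ j

  IsCycle : ℤ → ℤ → (B → ℤ) → Set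
  IsCycle i j f = Supp (InDeg i j) f × (∀ t → d f t ≡ 0ℤ)

  cyc-+ : ∀ {i j f g} → IsCycle i j f → IsCycle i j g → IsCycle i j (λ b → f b + g b)
  cyc-+ {f = f} {g} (sf , zf) (sg , zg) =
    supp-+ sf sg , λ t → trans (app-+ enum coef f g t) (cong₂ _+_ (zf t) (zg t))

  cyc-0 : ∀ {i j} → IsCycle i j (λ _ → 0ℤ)
  cyc-0 = supp-0 , λ t → app-0 enum coef t

  cyc-neg : ∀ {i j f} → IsCycle i j f → IsCycle i j (λ b → - f b)
  cyc-neg {f = f} (sf , zf) = supp-neg sf , λ t → trans (app-neg enum coef f t) (cong -_ (zf t))

  CycCarrier : ℤ → ℤ → Set
  CycCarrier i j = Σ (B → ℤ) (IsCycle i j)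

  cycOps : (i j : ℤ) → (CycCarrier i j → CycCarrier i j → CycCarrier i j) × CycCarrier i j × (CycCarrier i j → CycCarrier i j)
  cycOps i j = (λ x y → (λ b → proj₁ x b + proj₁ y b) , cyc-+ (proj₂ x) (proj₂ y))
             , ((λ _ → 0ℤ) , cyc-0)
             , (λ x → (λ b → - proj₁ x b) , cyc-neg (proj₂ x))

  Cyc : ℤ → ℤ → Ab
  Cyc i j = record
    { C = CycCarrier i j
    ; _≈_ = λ x y → ∀ b → proj₁ x b ≡ proj₁ y b
    ; _⊕_ = proj₁ (cycOps i j)
    ; 0# = proj₁ (proj₂ (cycOps i j))
    ; ⊝_ = proj₂ (proj₂ (cycOps i j)) }

  Hom : ℤ → ℤ → Ab
  Hom i j = record
    { C = CycCarrier i j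
    ; _≈_ = λ x y → Σ (B → ℤ) λ c → Supp (InDeg (i - 1ℤ) j) c × (∀ b → proj₁ x b - proj₁ y b ≡ d c b)
    ; _⊕_ = proj₁ (cycOps i j)
    ; 0# = proj₁ (proj₂ (cycOps i j))
    ; ⊝_ = proj₂ (proj₂ (cycOps i j)) }

-- V-label: true = v₊ (degree +1), false = v₋ (degree −1)
vdeg : Bool → ℤ
vdeg true  = 1ℤ
vdeg false = - 1ℤ

-- R-label: true = x₀ (degree 0), false = x₋₂ (degree −2)
rdeg : Bool → ℤ
rdeg true  = 0ℤ
rdeg false = - (+ 2)

vdegL : List Bool → ℤ
vdegL xs = sumℤ (map vdeg xs)

rdegL : List Bool → ℤ
rdegL xs = sumℤ (map rdeg xs)

-- matrix coefficient of  Δ̄_h : R^{⊗h} → R^{⊗(h+1)}  (source, target)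
Δ̄coef : List Bool → List Bool → Bool
Δ̄coef []               (t ∷ [])          = t                           -- 1 ↦ x₀
Δ̄coef (true ∷ [])      (y ∷ z ∷ [])      = y ∧ z                       -- x₀ ↦ x₀⊗x₀
Δ̄coef (false ∷ [])     (y ∷ z ∷ [])      = (not y ∧ z) ∨ (y ∧ not z)   -- x₋₂ ↦ x₋₂⊗x₀ + x₀⊗x₋₂
Δ̄coef (x ∷ xs@(_ ∷ _)) (y ∷ ys)          = eqB x y ∧ Δ̄coef xs ys
Δ̄coef _                _                 = false

-- matrix coefficient of m̃' (two labels → one) and Δ̃' (one → two)
mΔcoef : List Bool → List Bool → Bool
mΔcoef (true ∷ true ∷ [])   (z ∷ []) = z
mΔcoef (true ∷ false ∷ [])  (z ∷ []) = not z
mΔcoef (false ∷ true ∷ [])  (z ∷ []) = not z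
mΔcoef (false ∷ false ∷ []) (z ∷ []) = false
mΔcoef (true ∷ [])  (y ∷ z ∷ []) = (y ∧ not z) ∨ (not y ∧ z)
mΔcoef (false ∷ []) (y ∷ z ∷ []) = not y ∧ not z
mΔcoef _ _ = false

-- degree-q part of R^{⊗i}, and the image of Δ̄_{i-1} (zero when i = 0)
RB : ℕ → Set
RB i = Vec Bool i

Δ̄app : (k : ℕ) → (RB k → ℤ) → RB (suc k) → ℤ
Δ̄app k = app (allVecs k) (λ s t → boolℤ (Δ̄coef (toList s) (toList t)))

InIm : (i : ℕ) → (RB i → ℤ) → Set
InIm zero    y = ∀ b → y b ≡ 0ℤ
InIm (suc k) y = Σ (RB k → ℤ) λ x → ∀ b → y b ≡ Δ̄app k x b

inIm-+ : ∀ i {y y'} → InIm i y → InIm i y' → InIm i (λ b → y b + y' b)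
inIm-+ zero p p' b = cong₂ _+_ (p b) (p' b)
inIm-+ (suc k) (x , p) (x' , p') =
  (λ s → x s + x' s) , λ b → trans (cong₂ _+_ (p b) (p' b)) (sym (app-+ (allVecs k) _ x x' b))

inIm-0 : ∀ i → InIm i (λ _ → 0ℤ)
inIm-0 zero b = refl
inIm-0 (suc k) = (λ _ → 0ℤ) , λ b → sym (app-0 (allVecs k) _ b)

inIm-neg : ∀ i {y} → InIm i y → InIm i (λ b → - y b)
inIm-neg zero p b = cong -_ (p b)
inIm-neg (suc k) (x , p) = (λ s → - x s) , λ b → trans (cong -_ (p b)) (sym (app-neg (allVecs k) _ x b))

RDeg : (i : ℕ) → ℤ → RB i → Set
RDeg i q b = rdegL (toList b) ≡ q

ImAb : ℕ → ℤ → Ab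
ImAb i q = record
  { C = Σ (RB i → ℤ) λ y → Supp (RDeg i q) y × InIm i y
  ; _≈_ = λ x y → ∀ b → proj₁ x b ≡ proj₁ y b
  ; _⊕_ = λ x y → (λ b → proj₁ x b + proj₁ y b) ,
                   supp-+ (proj₁ (proj₂ x)) (proj₁ (proj₂ y)) , inIm-+ i (proj₂ (proj₂ x)) (proj₂ (proj₂ y))
  ; 0# = (λ _ → 0ℤ) , supp-0 , inIm-0 i
  ; ⊝_ = λ x → (λ b → - proj₁ x b) , supp-neg (proj₁ (proj₂ x)) , inIm-neg i (proj₂ (proj₂ x)) }

QuotAb : ℕ → ℤ → Ab
QuotAb i q = record
  { C = Σ (RB i → ℤ) (Supp (RDeg i q))
  ; _≈_ = λ x y → InIm i (λ b → proj₁ x b - proj₁ y b)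
  ; _⊕_ = λ x y → (λ b → proj₁ x b + proj₁ y b) , supp-+ (proj₂ x) (proj₂ y)
  ; 0# = (λ _ → 0ℤ) , supp-0
  ; ⊝_ = λ x → (λ b → - proj₁ x b) , supp-neg (proj₂ x) }

-- half-edges: edge e ∈ Fin n together with one of its two ends
HE : ℕ → Set
HE n = Fin n × Bool

-- A fatgraph with n edges (numbered by Fin n), the vertices with at least
-- one half-edge being the cycles of the permutation σ (cyclic order of
-- half-edges at a vertex), plus `iso` isolated vertices.
record Fatgraph : Set where
  field
    n    : ℕ
    iso  : ℕ
    σ    : HE n → HE n
    σ⁻¹  : HE n → HE n
    σ⁻¹σ : ∀ x → σ⁻¹ (σ x) ≡ x
    σσ⁻¹ : ∀ x → σ (σ⁻¹ x) ≡ x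

module FG (F : Fatgraph) where
  open Fatgraph F public

  e[F] : ℕ
  e[F] = n

  N : ℕ
  N = n ℕ.+ n

  key : HE n → ℕ
  key (e , false) = 2 ℕ.* toℕ e
  key (e , true)  = suc (2 ℕ.* toℕ e)

  _==_ : HE n → HE n → Bool
  x == y = key x ≡ᵇ key y

  ι : HE n → HE n
  ι (e , b) = e , not b

  halfEdges : List (HE n)
  halfEdges = concatMap (λ e → (e , false) ∷ (e , true) ∷ []) (allFin n)

  count : (HE n → Bool) → ℕ
  count P = length (filterᵇ P halfEdges)

  iter : (HE n → HE n) → ℕ → HE n → HE n
  iter f zero    x = x
  iter f (suc k) x = iter f k (f x)

  orbit : (HE n → HE n) → HE n → List (HE n)
  orbit f x = map (λ k → iter f k x) (upTo (suc N))

  orbitMin : (HE n → HE n) → HE n → ℕ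
  orbitMin f x = foldr (λ y m → key y ⊓ m) (key x) (orbit f x)

  isRep : (HE n → HE n) → HE n → Bool
  isRep f x = key x ≡ᵇ orbitMin f x

  -- states: α ∈ {0,1}^n, α_i = true (=1) iff edge i is deleted
  State : Set
  State = Vec Bool n

  present : State → HE n → Bool
  present α x = not (lookup α (proj₁ x))

  -- the cyclic order of the spanning fatsubgraph: next present half-edge
  nextP : State → ℕ → HE n → HE n → HE n
  nextP α zero    y x = x
  nextP α (suc k) y x = if present α y then y else nextP α k (σ y) x

  σW : State → HE n → HE n
  σW α x = nextP α N (σ x) x

  -- boundary-walk permutation of the state
  φ : State → HE n → HE n
  φ α x = σW α (ι x)

  vF : ℕ
  vF = count (isRep σ) ℕ.+ iso

  countTrue : ∀ {k} → Vec Bool k → ℕ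
  countTrue []           = 0
  countTrue (true ∷ xs)  = suc (countTrue xs)
  countTrue (false ∷ xs) = countTrue xs

  -- h(H) = e(F) − e(H)
  h : State → ℕ
  h α = countTrue α

  e : State → ℕ
  e α = n ∸ h α

  bare : State → HE n → Bool
  bare α x = allB (λ y → not (present α y)) (orbit σ x)

  -- keys of the boundary components of the state (in a fixed order):
  -- boundary cycles of present half-edges, vertices all of whose
  -- half-edges are deleted, isolated vertices
  bkeys : State → List ℕ
  bkeys α = map key (filterᵇ (λ x → present α x ∧ isRep (φ α) x) halfEdges)
         ++ map key (filterᵇ (λ x → bare α x ∧ isRep σ x) halfEdges)
         ++ map (λ i → N ℕ.+ i) (upTo iso)

  p : State → ℕ
  p α = length (bkeys α)

  reach : State → ℕ → HE n → HE n → Bool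
  reach α zero    x y = x == y
  reach α (suc k) x y = (x == y) ∨ reach α k (σ x) y ∨ (present α x ∧ reach α k (ι x) y)

  compRep : State → HE n → Bool
  compRep α x = not (anyB (λ y → (key y <ᵇ key x) ∧ reach α N x y) halfEdges)

  k : State → ℕ
  k α = count (compRep α) ℕ.+ iso

  -- genus via Euler characteristic: v − e + p = 2k − 2g
  g : State → ℕ
  g α = ⌊ ((2 ℕ.* k α ℕ.+ e α) ∸ (vF ℕ.+ p α)) /2⌋

  record HatB : Set where
    constructor hb
    field
      st : State
      vl : Vec Bool vF
      bl : Vec Bool (p st)
      gl : Vec Bool (2 ℕ.* g st)

  record TilB : Set where
    constructor tb
    field
      hp : HatB
      rl : Vec Bool (h (HatB.st hp))

  allHat : List HatB
  allHat = concatMap (λ α → concatMap (λ vl → concatMap (λ bl →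
             map (λ gl → hb α vl bl gl) (allVecs _)) (allVecs _)) (allVecs vF)) (allVecs n)

  allTil : List TilB
  allTil = concatMap (λ b → map (tb b) (allVecs _)) allHat

  hatDeg : HatB → ℤ
  hatDeg (hb α vl bl gl) = vdegL (toList vl) + vdegL (toList bl) + vdegL (toList gl) + + h α

  tilDeg : TilB → ℤ
  tilDeg (tb b rl) = hatDeg b + rdegL (toList rl)

  hatHgt : HatB → ℤ
  hatHgt b = + h (HatB.st b)

  lookupKey : List ℕ → List Bool → ℕ → Bool
  lookupKey (x ∷ xs) (l ∷ ls) q = if x ≡ᵇ q then l else lookupKey xs ls q
  lookupKey _        _        q = false

  memb : ℕ → List ℕ → Bool
  memb q xs = anyB (q ≡ᵇ_) xs

  sign : State → Fin n → ℤ
  sign α j = (- 1ℤ) ℤ.^ length (filterᵇ (λ i → (toℕ i <ᵇ toℕ j) ∧ lookup α i) (allFin n))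

  -- coefficient of target t in the per-edge map of edge j applied to source s
  -- (V-part of the restricted Bollobás–Riordan complex), as a Boolean
  edgeHat : Fin n → HatB → HatB → Bool
  edgeHat j (hb α vl bl gl) (hb α' vl' bl' gl') =
      not (lookup α j) ∧ eqL (toList α') (toList (α [ j ]≔ true))
    ∧ eqL (toList vl) (toList vl')
    ∧ unaffOK ∧ mΔcoef oldAff newAff ∧ genusOK
    where
      ka = orbitMin (φ α) (j , false)
      kb = orbitMin (φ α) (j , true)
      L  = bkeys α
      L' = bkeys α'
      lab  = lookupKey L (toList bl)
      lab' = lookupKey L' (toList bl')
      Lu = filterᵇ (λ q → not (q ≡ᵇ ka) ∧ not (q ≡ᵇ kb)) L
      unaffOK = allB (λ q → not (memb q Lu) ∨ eqB (lab' q) (lab q)) L'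
      oldAff = if ka ≡ᵇ kb then lab ka ∷ [] else lab ka ∷ lab kb ∷ []
      newAff = map lab' (filterᵇ (λ q → not (memb q Lu)) L')
      genusOK = if g α ≡ᵇ g α' then eqL (toList gl) (toList gl')
                else (if g α ≡ᵇ suc (g α') then ⌊ vdegL (toList gl) ≡? vdegL (toList gl') ⌋ else false)
        where
          open import Relation.Nullary.Decidable using (⌊_⌋)
          open import Data.Integer.Properties using () renaming (_≟_ to _≡?_)

  hatCoef : HatB → HatB → ℤ
  hatCoef s t = sumℤ (map (λ j → sign (HatB.st s) j * boolℤ (edgeHat j s t)) (allFin n))

  tilCoef : TilB → TilB → ℤ
  tilCoef (tb s r) (tb t r') =
    sumℤ (map (λ j → sign (HatB.st s) j * boolℤ (edgeHat j s t ∧ Δ̄coef (toList r) (toList r'))) (allFin n))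

  hatCx : Cx
  hatCx = record { B = HatB ; enum = allHat ; hgt = hatHgt ; deg = hatDeg ; coef = hatCoef }

  tilCx : Cx
  tilCx = record { B = TilB ; enum = allTil ; hgt = λ b → hatHgt (TilB.hp b) ; deg = tilDeg ; coef = tilCoef }

  -- C(F) = C̃(F)[−e(F)],  (C[s])^i = C^{i−s}
  CCx : Cx
  CCx = record tilCx { hgt = λ b → hatHgt (TilB.hp b) - + n }

  -- right-hand side of Proposition 5.3, summing over q ∈ {0,−1,…,−2i}
  -- (all degrees in which R^{⊗i} is nonzero), p = j − q
  RHS : ℕ → ℤ → Ab
  RHS i j = ⨁ (upTo (suc (2 ℕ.* i))) λ m →
              let q = - (+ m) in
              (Hom hatCx (+ i) (j - q) ⊗ ImAb i q) ⊞ (Cyc hatCx (+ i) (j - q) ⊗ QuotAb i q)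

module Submission where

-- Write C̃ⁱ = Ĉⁱ ⊗ R^{⊗i}; the differential is d̃ = d̂ ⊗ Δ̄ᵢ.  The map Δ̄ = Δ̄ᵢ₋₁ is a split
-- injection of free modules: the tensors Δ̄(w) form a basis of its image, the tensors w ⊗ x₋₂
-- a basis of a complement Q ≅ R^{⊗i}/Im Δ̄, and the coefficient of w ⊗ x₀ in Δ̄(u) is δ(u,w),
-- so reading off those coefficients inverts Δ̄.  Since Δ̄ᵢ is injective, a d̃-cycle is an
-- element of Ẑⁱ ⊗ R^{⊗i} = (Ẑⁱ ⊗ Im Δ̄) ⊕ (Ẑⁱ ⊗ Q); and the d̃-boundaries Σ d̂(cᵤ) ⊗ Δ̄(u) are
-- exactly B̂ⁱ ⊗ Im Δ̄.  Hence H̃ⁱ ≅ (Ĥⁱ ⊗ Im Δ̄) ⊕ (Ẑⁱ ⊗ Q), split by internal degree.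
-- The comparison with C(F) only relabels the height.

open import Defs
open import Data.Bool using (Bool; true; false; _∧_; not; if_then_else_)
open import Data.Nat as ℕ using (ℕ; zero; suc)
import Data.Nat.Properties as ℕP
open import Data.Integer as ℤ using (ℤ; +_; 0ℤ; 1ℤ; _+_; _-_; _*_; -_; -[1+_])
import Data.Integer.Properties as ℤP
open import Data.Integer.Tactic.RingSolver using (solve-∀)
open import Algebra.Properties.CommutativeSemigroup ℤP.*-commutativeSemigroup using (x∙yz≈y∙xz)
open import Data.Fin as Fin using (Fin)
open import Data.Vec using (Vec; []; _∷_; toList; _∷ʳ_; lookup; _[_]≔_)
import Data.Vec.Properties as VP
open import Data.List using (List; []; _∷_; _++_; foldr; concatMap; map; length; allFin; upTo)
import Data.List.Properties as LP
open import Data.List.Relation.Unary.All as All using (All; []; _∷_)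
open import Data.List.Relation.Unary.AllPairs using ([]; _∷_)
open import Data.List.Relation.Unary.Unique.Propositional using (Unique)
open import Data.List.Relation.Unary.Unique.Propositional.Properties using (upTo⁺)
open import Data.List.Relation.Unary.Any using (here; there)
open import Data.List.Membership.Propositional using (_∈_)
open import Data.List.Membership.Propositional.Properties using (∈-upTo⁺)
open import Data.Product using (Σ; _×_; _,_; proj₁; proj₂)
open import Data.Sum using (inj₁; inj₂; [_,_]′)
open import Data.Empty using (⊥; ⊥-elim)
open import Data.Unit using (⊤; tt)
open import Relation.Nullary using (Dec; yes; no)
open import Relation.Binary.PropositionalEquality using (_≡_; _≢_; refl; sym; trans; cong; cong₂; subst)

sumL : {A : Set} → List A → (A → ℤ) → ℤ
sumL L f = foldr (λ x r → f x + r) 0ℤ L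

sumL-cong : {A : Set} (L : List A) {f g : A → ℤ} → (∀ x → f x ≡ g x) → sumL L f ≡ sumL L g
sumL-cong []      e = refl
sumL-cong (x ∷ L) e = cong₂ _+_ (e x) (sumL-cong L e)

sumL-+ : {A : Set} (L : List A) (f g : A → ℤ) → sumL L (λ x → f x + g x) ≡ sumL L f + sumL L g
sumL-+ []      f g = refl
sumL-+ (x ∷ L) f g =
  trans (cong (_+_ (f x + g x)) (sumL-+ L f g)) (interchange (f x) (g x) (sumL L f) (sumL L g))

sumL-0 : {A : Set} (L : List A) → sumL L (λ _ → 0ℤ) ≡ 0ℤ
sumL-0 []      = refl
sumL-0 (x ∷ L) = trans (ℤP.+-identityˡ _) (sumL-0 L)

sumL-zero : {A : Set} (L : List A) {f : A → ℤ} → (∀ x → f x ≡ 0ℤ) → sumL L f ≡ 0ℤ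
sumL-zero L e = trans (sumL-cong L e) (sumL-0 L)

sumL-*ˡ : {A : Set} (L : List A) (c : ℤ) (f : A → ℤ) → sumL L (λ x → c * f x) ≡ c * sumL L f
sumL-*ˡ []      c f = sym (ℤP.*-zeroʳ c)
sumL-*ˡ (x ∷ L) c f = trans (cong (_+_ (c * f x)) (sumL-*ˡ L c f)) (sym (ℤP.*-distribˡ-+ c (f x) (sumL L f)))

sumL-*ʳ : {A : Set} (L : List A) (c : ℤ) (f : A → ℤ) → sumL L (λ x → f x * c) ≡ sumL L f * c
sumL-*ʳ L c f = trans (sumL-cong L (λ x → ℤP.*-comm (f x) c)) (trans (sumL-*ˡ L c f) (ℤP.*-comm c _))

sumL-neg : {A : Set} (L : List A) (f : A → ℤ) → sumL L (λ x → - f x) ≡ - sumL L f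
sumL-neg []      f = refl
sumL-neg (x ∷ L) f = trans (cong (_+_ (- f x)) (sumL-neg L f)) (sym (ℤP.neg-distrib-+ (f x) (sumL L f)))

sumL-- : {A : Set} (L : List A) (f g : A → ℤ) → sumL L (λ x → f x - g x) ≡ sumL L f - sumL L g
sumL-- L f g = trans (sumL-+ L f (λ x → - g x)) (cong (_+_ (sumL L f)) (sumL-neg L g))

sumL-++ : {A : Set} (L M : List A) (f : A → ℤ) → sumL (L ++ M) f ≡ sumL L f + sumL M f
sumL-++ []      M f = sym (ℤP.+-identityˡ _)
sumL-++ (x ∷ L) M f = trans (cong (_+_ (f x)) (sumL-++ L M f)) (sym (ℤP.+-assoc (f x) _ _))

sumL-concatMap : {A B : Set} (g : A → List B) (L : List A) (f : B → ℤ) →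
                 sumL (concatMap g L) f ≡ sumL L (λ x → sumL (g x) f)
sumL-concatMap g []      f = refl
sumL-concatMap g (x ∷ L) f =
  trans (sumL-++ (g x) (concatMap g L) f) (cong (_+_ (sumL (g x) f)) (sumL-concatMap g L f))

sumL-map : {A B : Set} (h : A → B) (L : List A) (f : B → ℤ) → sumL (map h L) f ≡ sumL L (λ x → f (h x))
sumL-map h []      f = refl
sumL-map h (x ∷ L) f = cong (_+_ (f (h x))) (sumL-map h L f)

sumL-swap : {A B : Set} (L : List A) (M : List B) (F : A → B → ℤ) →
            sumL L (λ x → sumL M (F x)) ≡ sumL M (λ y → sumL L (λ x → F x y))
sumL-swap []      M F = sym (sumL-0 M)
sumL-swap (x ∷ L) M F =
  trans (cong (_+_ (sumL M (F x))) (sumL-swap L M F)) (sym (sumL-+ M (F x) (λ y → sumL L (λ x' → F x' y))))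

supp-sumL : {B A : Set} {P : B → Set} (L : List A) (f : A → B → ℤ) →
            (∀ w → Supp P (f w)) → Supp P (λ r → sumL L (λ w → f w r))
supp-sumL []      f h = supp-0
supp-sumL (w ∷ L) f h = supp-+ (h w) (supp-sumL L f h)

app≡sumL : {A B : Set} (L : List A) (c : A → B → ℤ) (f : A → ℤ) (t : B) →
           app L c f t ≡ sumL L (λ s → c s t * f s)
app≡sumL []      c f t = refl
app≡sumL (s ∷ L) c f t = cong (_+_ (c s t * f s)) (app≡sumL L c f t)

app-cong : {A B : Set} (L : List A) (c : A → B → ℤ) {f g : A → ℤ} → (∀ s → f s ≡ g s) →
           ∀ t → app L c f t ≡ app L c g t
app-cong []      c e t = refl
app-cong (s ∷ L) c e t = cong₂ _+_ (cong (c s t *_) (e s)) (app-cong L c e t)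

app-zero : {A B : Set} (L : List A) (c : A → B → ℤ) {f : A → ℤ} → (∀ s → f s ≡ 0ℤ) → ∀ t → app L c f t ≡ 0ℤ
app-zero L c e t = trans (app-cong L c e t) (app-0 L c t)

sumℤ-map : {A : Set} (L : List A) (h : A → ℤ) → sumℤ (map h L) ≡ sumL L h
sumℤ-map []      h = refl
sumℤ-map (x ∷ L) h = cong (_+_ (h x)) (sumℤ-map L h)

dec-elim : {P C : Set} → Dec P → (P → C) → ((P → ⊥) → C) → C
dec-elim (yes p) f g = f p
dec-elim (no ¬p) f g = g ¬p

keep-if : {P : Set} → Dec P → ℤ → ℤ
keep-if (yes _) x = x
keep-if (no _)  x = 0ℤ

keep-if-elim : {P : Set} (d : Dec P) {x y : ℤ} → (P → x ≡ y) → ((P → ⊥) → 0ℤ ≡ y) → keep-if d x ≡ y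
keep-if-elim (yes p) f g = f p
keep-if-elim (no ¬p) f g = g ¬p

keep-if-* : {P : Set} (d : Dec P) (x y : ℤ) → keep-if d x * keep-if d y ≡ keep-if d (x * y)
keep-if-* (yes _) x y = refl
keep-if-* (no _)  x y = refl

keep-if-+ : {P : Set} (d : Dec P) (x y : ℤ) → keep-if d (x + y) ≡ keep-if d x + keep-if d y
keep-if-+ (yes _) x y = refl
keep-if-+ (no _)  x y = refl

boolℤ-∧ : ∀ a b → boolℤ (a ∧ b) ≡ boolℤ a * boolℤ b
boolℤ-∧ true  b = sym (ℤP.*-identityˡ (boolℤ b))
boolℤ-∧ false b = refl

∧-false : ∀ a → a ∧ false ≡ false
∧-false true  = refl
∧-false false = refl

∧-trueʳ : ∀ a → a ∧ true ≡ a
∧-trueʳ true  = refl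
∧-trueʳ false = refl

∧-true⇒ʳ : ∀ {a b} → a ∧ b ≡ true → b ≡ true
∧-true⇒ʳ {true} e = e

not-true : ∀ {a} → not a ≡ true → a ≡ false
not-true {false} e = refl

∧∧-false : ∀ a b c → (a ≡ true → b ≡ true → ⊥) → a ∧ (b ∧ c) ≡ false
∧∧-false false b     c h = refl
∧∧-false true  false c h = refl
∧∧-false true  true  c h = ⊥-elim (h refl refl)

eqV : ∀ {n} → Vec Bool n → Vec Bool n → Bool
eqV u v = eqL (toList u) (toList v)

eqV-sym : ∀ {n} (u v : Vec Bool n) → eqV u v ≡ eqV v u
eqV-sym []         []         = refl
eqV-sym (true ∷ u)  (true ∷ v)  = eqV-sym u v
eqV-sym (true ∷ u)  (false ∷ v) = refl
eqV-sym (false ∷ u) (true ∷ v)  = refl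
eqV-sym (false ∷ u) (false ∷ v) = eqV-sym u v

eqV-sound : ∀ {n} (u v : Vec Bool n) → eqV u v ≡ true → u ≡ v
eqV-sound []          []          e = refl
eqV-sound (true ∷ u)  (true ∷ v)  e = cong (true ∷_) (eqV-sound u v e)
eqV-sound (false ∷ u) (false ∷ v) e = cong (false ∷_) (eqV-sound u v e)
eqV-sound (true ∷ u)  (false ∷ v) ()
eqV-sound (false ∷ u) (true ∷ v)  ()

eqV-∷ʳ : ∀ {n} (u w : Vec Bool n) b c → eqV (u ∷ʳ b) (w ∷ʳ c) ≡ eqV u w ∧ eqB b c
eqV-∷ʳ []          []          true  true  = refl
eqV-∷ʳ []          []          true  false = refl
eqV-∷ʳ []          []          false true  = refl
eqV-∷ʳ []          []          false false = refl
eqV-∷ʳ (true ∷ u)  (true ∷ w)  b c = eqV-∷ʳ u w b c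
eqV-∷ʳ (true ∷ u)  (false ∷ w) b c = refl
eqV-∷ʳ (false ∷ u) (true ∷ w)  b c = refl
eqV-∷ʳ (false ∷ u) (false ∷ w) b c = eqV-∷ʳ u w b c

1*x+0≡x : ∀ x → 1ℤ * x + 0ℤ ≡ x
1*x+0≡x x = trans (ℤP.+-identityʳ _) (ℤP.*-identityˡ x)

sumL-δ : ∀ k (z : Vec Bool k → ℤ) (u : Vec Bool k) → sumL (allVecs k) (λ v → boolℤ (eqV v u) * z v) ≡ z u
sumL-δ zero    z []          = 1*x+0≡x (z [])
sumL-δ (suc k) z (true ∷ u)  =
  trans (sumL-concatMap (λ v → (true ∷ v) ∷ (false ∷ v) ∷ []) (allVecs k) (λ v → boolℤ (eqV v (true ∷ u)) * z v))
  (trans (sumL-cong (allVecs k) {g = λ v → boolℤ (eqV v u) * z (true ∷ v)} (λ v → ℤP.+-identityʳ _))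
         (sumL-δ k (λ v → z (true ∷ v)) u))
sumL-δ (suc k) z (false ∷ u) =
  trans (sumL-concatMap (λ v → (true ∷ v) ∷ (false ∷ v) ∷ []) (allVecs k) (λ v → boolℤ (eqV v (false ∷ u)) * z v))
  (trans (sumL-cong (allVecs k) {g = λ v → boolℤ (eqV v u) * z (false ∷ v)}
                    (λ v → trans (ℤP.+-identityˡ _) (ℤP.+-identityʳ _)))
         (sumL-δ k (λ v → z (false ∷ v)) u))

sumL-δ′ : ∀ k (z : Vec Bool k → ℤ) (u : Vec Bool k) → sumL (allVecs k) (λ v → boolℤ (eqV u v) * z v) ≡ z u
sumL-δ′ k z u = trans (sumL-cong (allVecs k) (λ v → cong (λ b → boolℤ b * z v) (eqV-sym u v))) (sumL-δ k z u)

∷ʳ-view : ∀ {k} (r : Vec Bool (suc k)) → Σ (Vec Bool k) λ u → Σ Bool λ b → r ≡ u ∷ʳ b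
∷ʳ-view (x ∷ [])    = [] , x , refl
∷ʳ-view (x ∷ y ∷ r) with ∷ʳ-view (y ∷ r)
... | u , b , e = (x ∷ u) , b , cong (x ∷_) e

padded : (n : ℕ) → List Bool → Vec Bool n
padded zero    _        = []
padded (suc n) []       = false ∷ padded n []
padded (suc n) (x ∷ xs) = x ∷ padded n xs

-- Only meaningful when m ≡ n; otherwise a junk vector.  It lets us index R^{⊗h(H)} for a
-- state H by R^{⊗i} without transporting along h(H) ≡ i.
resize : ∀ {m} n → Vec Bool m → Vec Bool n
resize n v = padded n (toList v)

resize-id : ∀ {n} (v : Vec Bool n) → resize n v ≡ v
resize-id []      = refl
resize-id (x ∷ v) = cong (x ∷_) (resize-id v)

toList-padded : ∀ n (l : List Bool) → length l ≡ n → toList (padded n l) ≡ l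
toList-padded zero    []      e = refl
toList-padded (suc n) (x ∷ l) e = cong (x ∷_) (toList-padded n l (ℕP.suc-injective e))

toList-resize : ∀ {m} n (v : Vec Bool m) → m ≡ n → toList (resize n v) ≡ toList v
toList-resize n v e = toList-padded n (toList v) (trans (VP.length-toList v) e)

resize-resize : ∀ {n i} (r : Vec Bool n) → n ≡ i → resize n (resize i r) ≡ r
resize-resize r refl = trans (cong (resize _) (resize-id r)) (resize-id r)

rdegL-++ : ∀ xs ys → rdegL (xs ++ ys) ≡ rdegL xs + rdegL ys
rdegL-++ []       ys = sym (ℤP.+-identityˡ _)
rdegL-++ (x ∷ xs) ys = trans (cong (_+_ (rdeg x)) (rdegL-++ xs ys)) (sym (ℤP.+-assoc (rdeg x) _ _))

rdeg-∷ʳ : ∀ {n} (w : Vec Bool n) b → rdegL (toList (w ∷ʳ b)) ≡ rdegL (toList w) + rdeg b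
rdeg-∷ʳ w b =
  trans (cong rdegL (VP.toList-∷ʳ b w))
        (trans (rdegL-++ (toList w) (b ∷ [])) (cong (_+_ (rdegL (toList w))) (ℤP.+-identityʳ (rdeg b))))

rdeg-∷ʳ-x₀ : ∀ {n} (w : Vec Bool n) → rdegL (toList (w ∷ʳ true)) ≡ rdegL (toList w)
rdeg-∷ʳ-x₀ w = trans (rdeg-∷ʳ w true) (ℤP.+-identityʳ _)

#x₋₂ : ∀ {n} → Vec Bool n → ℕ
#x₋₂ []          = 0
#x₋₂ (true ∷ v)  = #x₋₂ v
#x₋₂ (false ∷ v) = suc (#x₋₂ v)

#x₋₂≤length : ∀ {n} (v : Vec Bool n) → #x₋₂ v ℕ.≤ n
#x₋₂≤length []          = ℕ.z≤n
#x₋₂≤length (true ∷ v)  = ℕP.m≤n⇒m≤1+n (#x₋₂≤length v)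
#x₋₂≤length (false ∷ v) = ℕ.s≤s (#x₋₂≤length v)

rdeg≡-2#x₋₂ : ∀ {n} (v : Vec Bool n) → rdegL (toList v) ≡ - (+ (2 ℕ.* #x₋₂ v))
rdeg≡-2#x₋₂ []          = refl
rdeg≡-2#x₋₂ (true ∷ v)  = trans (ℤP.+-identityˡ _) (rdeg≡-2#x₋₂ v)
rdeg≡-2#x₋₂ (false ∷ v) =
  trans (cong (_+_ (- (+ 2))) (rdeg≡-2#x₋₂ v))
  (trans (sym (ℤP.neg-distrib-+ (+ 2) (+ (2 ℕ.* #x₋₂ v))))
         (cong (λ z → - (+ z)) (sym (ℕP.*-distribˡ-+ 2 1 (#x₋₂ v)))))

rdeg-range : ∀ {n} i (v : Vec Bool n) → n ℕ.≤ i → Σ ℕ λ c → rdegL (toList v) ≡ - (+ c) × c ℕ.< suc (2 ℕ.* i)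
rdeg-range i v n≤i =
  2 ℕ.* #x₋₂ v , rdeg≡-2#x₋₂ v , ℕ.s≤s (ℕP.*-monoʳ-≤ 2 (ℕP.≤-trans (#x₋₂≤length v) n≤i))

Δ̄coef-∷ʳ-x₀ : ∀ {k} (r w : Vec Bool k) → Δ̄coef (toList r) (toList (w ∷ʳ true)) ≡ eqV r w
Δ̄coef-∷ʳ-x₀ []              []          = refl
Δ̄coef-∷ʳ-x₀ (true ∷ [])     (true ∷ [])  = refl
Δ̄coef-∷ʳ-x₀ (true ∷ [])     (false ∷ []) = refl
Δ̄coef-∷ʳ-x₀ (false ∷ [])    (true ∷ [])  = refl
Δ̄coef-∷ʳ-x₀ (false ∷ [])    (false ∷ []) = refl
Δ̄coef-∷ʳ-x₀ (true ∷ y ∷ r)  (a ∷ w)      = cong (eqB true a ∧_) (Δ̄coef-∷ʳ-x₀ (y ∷ r) w)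
Δ̄coef-∷ʳ-x₀ (false ∷ y ∷ r) (a ∷ w)      = cong (eqB false a ∧_) (Δ̄coef-∷ʳ-x₀ (y ∷ r) w)

Δ̄coef⇒length : ∀ xs ys → Δ̄coef xs ys ≡ true → length ys ≡ suc (length xs)
Δ̄coef⇒length [] (t ∷ []) _ = refl
Δ̄coef⇒length [] [] ()
Δ̄coef⇒length [] (true ∷ _ ∷ _) ()
Δ̄coef⇒length [] (false ∷ _ ∷ _) ()
Δ̄coef⇒length (true ∷ []) (y ∷ z ∷ []) _ = refl
Δ̄coef⇒length (false ∷ []) (y ∷ z ∷ []) _ = refl
Δ̄coef⇒length (true ∷ []) [] ()
Δ̄coef⇒length (false ∷ []) [] ()
Δ̄coef⇒length (true ∷ []) (_ ∷ []) ()
Δ̄coef⇒length (false ∷ []) (_ ∷ []) ()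
Δ̄coef⇒length (true ∷ []) (_ ∷ _ ∷ _ ∷ _) ()
Δ̄coef⇒length (false ∷ []) (_ ∷ _ ∷ _ ∷ _) ()
Δ̄coef⇒length (true ∷ y ∷ xs) [] ()
Δ̄coef⇒length (false ∷ y ∷ xs) [] ()
Δ̄coef⇒length (true ∷ y ∷ xs) (a ∷ ys) e = cong suc (Δ̄coef⇒length (y ∷ xs) ys (∧-true⇒ʳ {eqB true a} e))
Δ̄coef⇒length (false ∷ y ∷ xs) (a ∷ ys) e = cong suc (Δ̄coef⇒length (y ∷ xs) ys (∧-true⇒ʳ {eqB false a} e))

Δ̄coef-length-mismatch : ∀ xs ys → (length ys ≡ suc (length xs) → ⊥) → Δ̄coef xs ys ≡ false
Δ̄coef-length-mismatch xs ys ne with Δ̄coef xs ys in eq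
... | false = refl
... | true  = ⊥-elim (ne (Δ̄coef⇒length xs ys eq))

Δ̄coef⇒rdeg : ∀ xs ys → Δ̄coef xs ys ≡ true → rdegL ys ≡ rdegL xs
Δ̄coef⇒rdeg [] (true ∷ []) _ = refl
Δ̄coef⇒rdeg [] (false ∷ []) ()
Δ̄coef⇒rdeg [] [] ()
Δ̄coef⇒rdeg [] (true ∷ _ ∷ _) ()
Δ̄coef⇒rdeg [] (false ∷ _ ∷ _) ()
Δ̄coef⇒rdeg (true ∷ []) (true ∷ true ∷ []) _ = refl
Δ̄coef⇒rdeg (true ∷ []) (true ∷ false ∷ []) ()
Δ̄coef⇒rdeg (true ∷ []) (false ∷ _ ∷ []) ()
Δ̄coef⇒rdeg (false ∷ []) (true ∷ true ∷ []) ()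
Δ̄coef⇒rdeg (false ∷ []) (true ∷ false ∷ []) _ = refl
Δ̄coef⇒rdeg (false ∷ []) (false ∷ true ∷ []) _ = refl
Δ̄coef⇒rdeg (false ∷ []) (false ∷ false ∷ []) ()
Δ̄coef⇒rdeg (true ∷ []) [] ()
Δ̄coef⇒rdeg (false ∷ []) [] ()
Δ̄coef⇒rdeg (true ∷ []) (_ ∷ []) ()
Δ̄coef⇒rdeg (false ∷ []) (_ ∷ []) ()
Δ̄coef⇒rdeg (true ∷ []) (_ ∷ _ ∷ _ ∷ _) ()
Δ̄coef⇒rdeg (false ∷ []) (_ ∷ _ ∷ _ ∷ _) ()
Δ̄coef⇒rdeg (true ∷ y ∷ xs) [] ()
Δ̄coef⇒rdeg (false ∷ y ∷ xs) [] ()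
Δ̄coef⇒rdeg (true ∷ y ∷ xs) (true ∷ ys) e = cong (_+_ 0ℤ) (Δ̄coef⇒rdeg (y ∷ xs) ys e)
Δ̄coef⇒rdeg (true ∷ y ∷ xs) (false ∷ ys) ()
Δ̄coef⇒rdeg (false ∷ y ∷ xs) (true ∷ ys) ()
Δ̄coef⇒rdeg (false ∷ y ∷ xs) (false ∷ ys) e = cong (_+_ (- (+ 2))) (Δ̄coef⇒rdeg (y ∷ xs) ys e)

Δ̄sumL : ∀ k → (RB k → ℤ) → RB (suc k) → ℤ
Δ̄sumL k z r = sumL (allVecs k) (λ v → boolℤ (Δ̄coef (toList v) (toList r)) * z v)

Δ̄app≡Δ̄sumL : ∀ k x r → Δ̄app k x r ≡ Δ̄sumL k x r
Δ̄app≡Δ̄sumL k x r = app≡sumL (allVecs k) _ x r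

-- Reading off the coefficients of the tensors ending in x₀ is a left inverse of Δ̄.
Δ̄sumL-∷ʳ-x₀ : ∀ k (z : RB k → ℤ) u → Δ̄sumL k z (u ∷ʳ true) ≡ z u
Δ̄sumL-∷ʳ-x₀ k z u =
  trans (sumL-cong (allVecs k) (λ v → cong (λ b → boolℤ b * z v) (Δ̄coef-∷ʳ-x₀ v u))) (sumL-δ k z u)

Δ̄sumL-cong : ∀ k {z z' : RB k → ℤ} → (∀ v → z v ≡ z' v) → ∀ r → Δ̄sumL k z r ≡ Δ̄sumL k z' r
Δ̄sumL-cong k e r = sumL-cong (allVecs k) (λ v → cong (_*_ (boolℤ (Δ̄coef (toList v) (toList r)))) (e v))

Δ̄sumL-zero : ∀ k {z : RB k → ℤ} → (∀ v → z v ≡ 0ℤ) → ∀ r → Δ̄sumL k z r ≡ 0ℤ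
Δ̄sumL-zero k e r =
  trans (Δ̄sumL-cong k e r) (sumL-zero (allVecs k) (λ v → ℤP.*-zeroʳ (boolℤ (Δ̄coef (toList v) (toList r)))))

Δ̄sumL-lin : ∀ k {A : Set} (L : List A) (c : A → ℤ) (f : A → RB k → ℤ) r →
            Δ̄sumL k (λ v → sumL L (λ p → c p * f p v)) r ≡ sumL L (λ p → c p * Δ̄sumL k (f p) r)
Δ̄sumL-lin k L c f r =
  trans (sumL-cong (allVecs k) (λ v → sym (sumL-*ˡ L (B v) (λ p → c p * f p v))))
  (trans (sumL-swap (allVecs k) L (λ v p → B v * (c p * f p v)))
  (sumL-cong L (λ p → trans (sumL-cong (allVecs k) (λ v → x∙yz≈y∙xz (B v) (c p) (f p v)))
                            (sumL-*ˡ (allVecs k) (c p) (λ v → B v * f p v)))))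
  where B : RB k → ℤ
        B v = boolℤ (Δ̄coef (toList v) (toList r))

InIm-cong : ∀ i {y y' : RB i → ℤ} → (∀ r → y r ≡ y' r) → InIm i y → InIm i y'
InIm-cong zero    e p       b = trans (sym (e b)) (p b)
InIm-cong (suc k) e (x , p)   = x , λ b → trans (sym (e b)) (p b)

-- Splitting R^{⊗i} along the image of Δ̄

-- A homogeneous basis of R^{⊗i}: the eI span Im Δ̄ᵢ₋₁, the eQ a complement; κI and κQ are
-- the dual coordinate functionals.
record SplitBasis (i : ℕ) : Set₁ where
  field
    I J    : Set
    LI     : List I
    LJ     : List J
    eI     : I → RB i → ℤ
    eQ     : J → RB i → ℤ
    κI     : I → (RB i → ℤ) → ℤ
    κQ     : J → (RB i → ℤ) → ℤ
    dI     : I → ℤ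
    dQ     : J → ℤ
    eqJ    : J → J → Bool
    sumJ-δ  : ∀ (z : J → ℤ) w → sumL LJ (λ v → boolℤ (eqJ w v) * z v) ≡ z w
    sumJ-δ′ : ∀ (z : J → ℤ) w → sumL LJ (λ v → boolℤ (eqJ v w) * z v) ≡ z w
    κI-cong : ∀ w {y y' : RB i → ℤ} → (∀ r → y r ≡ y' r) → κI w y ≡ κI w y'
    κQ-cong : ∀ w {y y' : RB i → ℤ} → (∀ r → y r ≡ y' r) → κQ w y ≡ κQ w y'
    κI-lin  : ∀ w {A : Set} (L : List A) (c : A → ℤ) (f : A → RB i → ℤ) →
              κI w (λ r → sumL L (λ p → c p * f p r)) ≡ sumL L (λ p → c p * κI w (f p))
    κQ-lin  : ∀ w {A : Set} (L : List A) (c : A → ℤ) (f : A → RB i → ℤ) →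
              κQ w (λ r → sumL L (λ p → c p * f p r)) ≡ sumL L (λ p → c p * κQ w (f p))
    eI-deg  : ∀ w → Supp (RDeg i (dI w)) (eI w)
    eQ-deg  : ∀ w → Supp (RDeg i (dQ w)) (eQ w)
    κI-deg  : ∀ w q y → Supp (RDeg i q) y → (q ≡ dI w → ⊥) → κI w y ≡ 0ℤ
    κQ-deg  : ∀ w q y → Supp (RDeg i q) y → (q ≡ dQ w → ⊥) → κQ w y ≡ 0ℤ
    dI-range : ∀ w → Σ ℕ λ c → dI w ≡ - (+ c) × c ℕ.< suc (2 ℕ.* i)
    dQ-range : ∀ w → Σ ℕ λ c → dQ w ≡ - (+ c) × c ℕ.< suc (2 ℕ.* i)
    expand  : ∀ y r → y r ≡ sumL LI (λ w → κI w y * eI w r) + sumL LJ (λ w → κQ w y * eQ w r)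
    κQ-eQ   : ∀ w v → κQ w (eQ v) ≡ boolℤ (eqJ w v)
    κI-eQ   : ∀ w v → κI w (eQ v) ≡ 0ℤ
    eI-im   : ∀ w → InIm i (eI w)
    κQ-im   : ∀ w y → InIm i y → κQ w y ≡ 0ℤ
    y-Qpart-im : ∀ y → InIm i (λ r → y r - sumL LJ (λ w → κQ w y * eQ w r))

*-distribˡ-− : ∀ a b c → a * (b - c) ≡ a * b - a * c
*-distribˡ-− = solve-∀

m+[n-m]≡n : ∀ a b → a + (b - a) ≡ b
m+[n-m]≡n = solve-∀

[m+n]-n≡m : ∀ a b → (a + b) - b ≡ a
[m+n]-n≡m = solve-∀

[m-n]+n≡m : ∀ a b → (a - b) + b ≡ a
[m-n]+n≡m = solve-∀

ab+c≡b+ac : ∀ a b c → (a + b) + c ≡ b + (a + c)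
ab+c≡b+ac = solve-∀

ab-a'b≡[a-a']b : ∀ a a' b → a * b - a' * b ≡ (a - a') * b
ab-a'b≡[a-a']b = solve-∀

-- For i = k + 1: eI w = Δ̄(w), eQ w = w ⊗ x₋₂, and κI w y is the coefficient of w ⊗ x₀ in y.
-- Since the coefficient of u ⊗ x₀ in Δ̄(w) is δ(u,w), this basis is unitriangular with respect
-- to the standard one.
module SplitBasisSuc (k : ℕ) where
  eI : RB k → RB (suc k) → ℤ
  eI w r = boolℤ (Δ̄coef (toList w) (toList r))

  eQ : RB k → RB (suc k) → ℤ
  eQ w r = boolℤ (eqV r (w ∷ʳ false))

  κI : RB k → (RB (suc k) → ℤ) → ℤ
  κI w y = y (w ∷ʳ true)

  κQ : RB k → (RB (suc k) → ℤ) → ℤ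
  κQ w y = y (w ∷ʳ false) - Δ̄sumL k (λ v → y (v ∷ʳ true)) (w ∷ʳ false)

  κQ-lin : ∀ w {A : Set} (L : List A) (c : A → ℤ) (f : A → RB (suc k) → ℤ) →
           κQ w (λ r → sumL L (λ p → c p * f p r)) ≡ sumL L (λ p → c p * κQ w (f p))
  κQ-lin w L c f =
    trans (cong (_-_ (sumL L (λ p → c p * f p (w ∷ʳ false)))) (Δ̄sumL-lin k L c (λ p v → f p (v ∷ʳ true)) (w ∷ʳ false)))
    (sym (trans (sumL-cong L (λ p → *-distribˡ-− (c p) (f p (w ∷ʳ false)) (Δ̄sumL k (λ v → f p (v ∷ʳ true)) (w ∷ʳ false))))
                (sumL-- L (λ p → c p * f p (w ∷ʳ false)) (λ p → c p * Δ̄sumL k (λ v → f p (v ∷ʳ true)) (w ∷ʳ false)))))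

  eI-deg : ∀ w → Supp (RDeg (suc k) (rdegL (toList w))) (eI w)
  eI-deg w r with Δ̄coef (toList w) (toList r) in eq
  ... | false = inj₁ refl
  ... | true  = inj₂ (Δ̄coef⇒rdeg (toList w) (toList r) eq)

  eQ-deg : ∀ w → Supp (RDeg (suc k) (rdegL (toList (w ∷ʳ false)))) (eQ w)
  eQ-deg w r with eqV r (w ∷ʳ false) in eq
  ... | false = inj₁ refl
  ... | true  = inj₂ (cong (λ v → rdegL (toList v)) (eqV-sound r _ eq))

  κI-deg : ∀ w q y → Supp (RDeg (suc k) q) y → (q ≡ rdegL (toList w) → ⊥) → κI w y ≡ 0ℤ
  κI-deg w q y sy ne with sy (w ∷ʳ true)
  ... | inj₁ e = e
  ... | inj₂ e = ⊥-elim (ne (trans (sym e) (rdeg-∷ʳ-x₀ w)))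

  κQ-deg : ∀ w q y → Supp (RDeg (suc k) q) y → (q ≡ rdegL (toList (w ∷ʳ false)) → ⊥) → κQ w y ≡ 0ℤ
  κQ-deg w q y sy ne = cong₂ _-_ head-zero (sumL-zero (allVecs k) term-zero)
    where
      head-zero : y (w ∷ʳ false) ≡ 0ℤ
      head-zero with sy (w ∷ʳ false)
      ... | inj₁ e = e
      ... | inj₂ e = ⊥-elim (ne (sym e))
      term-zero : ∀ v → boolℤ (Δ̄coef (toList v) (toList (w ∷ʳ false))) * y (v ∷ʳ true) ≡ 0ℤ
      term-zero v with Δ̄coef (toList v) (toList (w ∷ʳ false)) in eq
      ... | false = refl
      ... | true with sy (v ∷ʳ true)
      ... | inj₁ e = cong (_*_ 1ℤ) e
      ... | inj₂ e = ⊥-elim (ne (trans (sym e) (trans (rdeg-∷ʳ-x₀ v) (sym (Δ̄coef⇒rdeg (toList v) _ eq)))))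

  expand : ∀ y r → y r ≡ sumL (allVecs k) (λ w → κI w y * eI w r) + sumL (allVecs k) (λ w → κQ w y * eQ w r)
  expand y r with ∷ʳ-view r
  ... | u , true , refl = sym (trans (cong₂ _+_ I-part Q-part) (ℤP.+-identityʳ _))
    where
      I-part : sumL (allVecs k) (λ w → κI w y * eI w (u ∷ʳ true)) ≡ y (u ∷ʳ true)
      I-part = trans (sumL-cong (allVecs k) {g = λ w → boolℤ (eqV w u) * y (w ∷ʳ true)}
                       (λ w → trans (ℤP.*-comm (y (w ∷ʳ true)) (eI w (u ∷ʳ true)))
                                    (cong (λ b → boolℤ b * y (w ∷ʳ true)) (Δ̄coef-∷ʳ-x₀ w u))))
                     (sumL-δ k (λ w → y (w ∷ʳ true)) u)
      Q-part : sumL (allVecs k) (λ w → κQ w y * eQ w (u ∷ʳ true)) ≡ 0ℤ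
      Q-part = sumL-zero (allVecs k) (λ w →
        trans (cong (λ b → κQ w y * boolℤ b) (trans (eqV-∷ʳ u w true false) (∧-false _))) (ℤP.*-zeroʳ (κQ w y)))
  ... | u , false , refl =
    sym (trans (cong₂ _+_ I-part Q-part) (m+[n-m]≡n (Δ̄sumL k (λ v → y (v ∷ʳ true)) (u ∷ʳ false)) (y (u ∷ʳ false))))
    where
      I-part : sumL (allVecs k) (λ w → κI w y * eI w (u ∷ʳ false)) ≡ Δ̄sumL k (λ v → y (v ∷ʳ true)) (u ∷ʳ false)
      I-part = sumL-cong (allVecs k) (λ w → ℤP.*-comm (y (w ∷ʳ true)) (eI w (u ∷ʳ false)))
      Q-part : sumL (allVecs k) (λ w → κQ w y * eQ w (u ∷ʳ false)) ≡ κQ u y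
      Q-part = trans (sumL-cong (allVecs k) {g = λ w → boolℤ (eqV u w) * κQ w y}
                       (λ w → trans (ℤP.*-comm (κQ w y) (eQ w (u ∷ʳ false)))
                                    (cong (λ b → boolℤ b * κQ w y) (trans (eqV-∷ʳ u w false false) (∧-trueʳ _)))))
                     (sumL-δ′ k (λ w → κQ w y) u)

  κQ-eQ : ∀ w v → κQ w (eQ v) ≡ boolℤ (eqV w v)
  κQ-eQ w v =
    trans (cong₂ _-_ (cong boolℤ (trans (eqV-∷ʳ w v false false) (∧-trueʳ _)))
                     (Δ̄sumL-zero k (λ u → cong boolℤ (trans (eqV-∷ʳ u v true false) (∧-false _))) (w ∷ʳ false)))
          (ℤP.+-identityʳ _)

  κI-eQ : ∀ w v → κI w (eQ v) ≡ 0ℤ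
  κI-eQ w v = cong boolℤ (trans (eqV-∷ʳ w v true false) (∧-false _))

  eI-im : ∀ w → InIm (suc k) (eI w)
  eI-im w = (λ u → boolℤ (eqV w u)) , λ b → sym (trans (Δ̄app≡Δ̄sumL k _ b)
    (trans (sumL-cong (allVecs k) (λ u → ℤP.*-comm (eI u b) (boolℤ (eqV w u)))) (sumL-δ′ k (λ u → eI u b) w)))

  κQ-im : ∀ w y → InIm (suc k) y → κQ w y ≡ 0ℤ
  κQ-im w y (x , y≡Δ̄x) =
    trans (cong (_-_ (y (w ∷ʳ false)))
      (trans (Δ̄sumL-cong k (λ v → trans (y≡Δ̄x (v ∷ʳ true)) (trans (Δ̄app≡Δ̄sumL k x _) (Δ̄sumL-∷ʳ-x₀ k x v)))
                            (w ∷ʳ false))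
             (trans (sym (Δ̄app≡Δ̄sumL k x _)) (sym (y≡Δ̄x (w ∷ʳ false))))))
      (ℤP.+-inverseʳ (y (w ∷ʳ false)))

  y-Qpart-im : ∀ y → InIm (suc k) (λ r → y r - sumL (allVecs k) (λ w → κQ w y * eQ w r))
  y-Qpart-im y = (λ v → y (v ∷ʳ true)) , λ r →
    trans (cong (λ z → z - sumL (allVecs k) (λ w → κQ w y * eQ w r)) (expand y r))
    (trans ([m+n]-n≡m (sumL (allVecs k) (λ w → κI w y * eI w r)) (sumL (allVecs k) (λ w → κQ w y * eQ w r)))
    (trans (sumL-cong (allVecs k) (λ w → ℤP.*-comm (y (w ∷ʳ true)) (eI w r))) (sym (Δ̄app≡Δ̄sumL k _ r))))

  splitBasis : SplitBasis (suc k)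
  splitBasis = record
    { I = RB k ; J = RB k ; LI = allVecs k ; LJ = allVecs k
    ; eI = eI ; eQ = eQ ; κI = κI ; κQ = κQ
    ; dI = λ w → rdegL (toList w) ; dQ = λ w → rdegL (toList (w ∷ʳ false))
    ; eqJ = eqV ; sumJ-δ = sumL-δ′ k ; sumJ-δ′ = sumL-δ k
    ; κI-cong = λ w e → e (w ∷ʳ true)
    ; κQ-cong = λ w e → cong₂ _-_ (e (w ∷ʳ false)) (Δ̄sumL-cong k (λ v → e (v ∷ʳ true)) (w ∷ʳ false))
    ; κI-lin = λ w L c f → refl
    ; κQ-lin = κQ-lin
    ; eI-deg = eI-deg ; eQ-deg = eQ-deg ; κI-deg = κI-deg ; κQ-deg = κQ-deg
    ; dI-range = λ w → rdeg-range (suc k) w (ℕP.n≤1+n k)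
    ; dQ-range = λ w → rdeg-range (suc k) (w ∷ʳ false) ℕP.≤-refl
    ; expand = expand
    ; κQ-eQ = κQ-eQ ; κI-eQ = κI-eQ
    ; eI-im = eI-im ; κQ-im = κQ-im ; y-Qpart-im = y-Qpart-im }

-- R^{⊗0} = ℤ, and Im Δ̄₋₁ = 0 by convention.
splitBasis0 : SplitBasis 0
splitBasis0 = record
  { I = ⊥ ; J = ⊤ ; LI = [] ; LJ = tt ∷ []
  ; eI = λ () ; eQ = λ _ _ → 1ℤ ; κI = λ () ; κQ = λ _ y → y []
  ; dI = λ () ; dQ = λ _ → 0ℤ
  ; eqJ = λ _ _ → true ; sumJ-δ = λ z w → 1*x+0≡x (z tt) ; sumJ-δ′ = λ z w → 1*x+0≡x (z tt)
  ; κI-cong = λ () ; κQ-cong = λ w e → e []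
  ; κI-lin = λ () ; κQ-lin = λ w L c f → refl
  ; eI-deg = λ () ; eQ-deg = λ { w [] → inj₂ refl }
  ; κI-deg = λ () ; κQ-deg = κQ-deg
  ; dI-range = λ () ; dQ-range = λ w → 0 , refl , ℕ.s≤s ℕ.z≤n
  ; expand = λ { y [] → sym (trans (ℤP.+-identityˡ _) (trans (ℤP.+-identityʳ _) (ℤP.*-identityʳ (y [])))) }
  ; κQ-eQ = λ w v → refl ; κI-eQ = λ ()
  ; eI-im = λ () ; κQ-im = λ w y y≡0 → y≡0 [] ; y-Qpart-im = λ { y [] → a-[a*1+0]≡0 (y []) } }
  where
    κQ-deg : (w : ⊤) (q : ℤ) (y : RB 0 → ℤ) → Supp (RDeg 0 q) y → (q ≡ 0ℤ → ⊥) → y [] ≡ 0ℤ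
    κQ-deg w q y sy ne = [ (λ e → e) , (λ e → ⊥-elim (ne (sym e))) ]′ (sy [])
    a-[a*1+0]≡0 : ∀ a → a - (a * 1ℤ + 0ℤ) ≡ 0ℤ
    a-[a*1+0]≡0 = solve-∀

ℕ-mul : (A : Ab) → ℕ → Ab.C A → Ab.C A
ℕ-mul A zero    x = Ab.0# A
ℕ-mul A (suc n) x = Ab._⊕_ A x (ℕ-mul A n x)

ℤ-mul : (A : Ab) → ℤ → Ab.C A → Ab.C A
ℤ-mul A (+ n)    x = ℕ-mul A n x
ℤ-mul A -[1+ n ] x = Ab.⊝_ A (ℕ-mul A (suc n) x)

linear-combination : (A : Ab) {W : Set} → List W → (W → ℤ) → (W → Ab.C A) → Ab.C A
linear-combination A L c e = foldr (λ w acc → Ab._⊕_ A (ℤ-mul A (c w) (e w)) acc) (Ab.0# A) L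

module Evaluation (A : Ab) {D : Set} (val : Ab.C A → D → ℤ)
  (val-⊕ : ∀ x y d → val (Ab._⊕_ A x y) d ≡ val x d + val y d)
  (val-0 : ∀ d → val (Ab.0# A) d ≡ 0ℤ)
  (val-⊝ : ∀ x d → val (Ab.⊝_ A x) d ≡ - val x d)
  where

  val-ℕ-mul : ∀ n x d → val (ℕ-mul A n x) d ≡ + n * val x d
  val-ℕ-mul zero    x d = val-0 d
  val-ℕ-mul (suc n) x d =
    trans (val-⊕ x _ d) (trans (cong (_+_ (val x d)) (val-ℕ-mul n x d)) (sym ([1+m]*v≡v+m*v (+ n) (val x d))))
    where
      [1+m]*v≡v+m*v : ∀ m v → (1ℤ + m) * v ≡ v + m * v
      [1+m]*v≡v+m*v = solve-∀

  val-ℤ-mul : ∀ n x d → val (ℤ-mul A n x) d ≡ n * val x d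
  val-ℤ-mul (+ n)    x d = val-ℕ-mul n x d
  val-ℤ-mul -[1+ n ] x d =
    trans (val-⊝ _ d) (trans (cong -_ (val-ℕ-mul (suc n) x d)) (ℤP.neg-distribˡ-* (+ suc n) (val x d)))

  val-linear-combination : ∀ {W : Set} (L : List W) (c : W → ℤ) (e : W → Ab.C A) d →
                           val (linear-combination A L c e) d ≡ sumL L (λ w → c w * val (e w) d)
  val-linear-combination []      c e d = val-0 d
  val-linear-combination (w ∷ L) c e d =
    trans (val-⊕ _ _ d) (cong₂ _+_ (val-ℤ-mul (c w) (e w) d) (val-linear-combination L c e d))

-- A is a group of ℤ-valued functions on D; B has elements e w with coordinate functions κ w,
-- in the sense that every b is the linear combination Σ κ w b · e w.
module TensorOverBasis (A B : Ab) {D : Set} (valA : Ab.C A → D → ℤ)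
  (valA-⊕ : ∀ x y d → valA (Ab._⊕_ A x y) d ≡ valA x d + valA y d)
  (valA-0 : ∀ d → valA (Ab.0# A) d ≡ 0ℤ)
  (valA-⊝ : ∀ x d → valA (Ab.⊝_ A x) d ≡ - valA x d)
  (valA-injective : ∀ {x y} → (∀ d → valA x d ≡ valA y d) → Ab._≈_ A x y)
  (B-inverseˡ : ∀ z → Ab._≈_ B (Ab._⊕_ B (Ab.⊝_ B z) z) (Ab.0# B))
  {W : Set} (LW : List W) (e : W → Ab.C B) (κ : W → Ab.C B → ℤ)
  (B-expand : ∀ b → Ab._≈_ B b (linear-combination B LW (λ w → κ w b) e))
  where
  open Tensor A B
  open Evaluation A valA valA-⊕ valA-0 valA-⊝
  private
    module A = Ab A
    module B = Ab B

  ≡⇒∼ : ∀ {x y} → x ≡ y → x ∼ y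
  ≡⇒∼ refl = t-refl

  cancel : ∀ X Y P P' → P ∼ P' → (X ++ P) ∼ [] → (Y ++ P') ∼ [] → X ∼ Y
  cancel X Y P P' P∼P' X+P∼0 Y+P'∼0 =
    t-trans (≡⇒∼ (sym (LP.++-identityʳ X)))
    (t-trans (t-++ (t-refl {X}) (t-sym Y+P'∼0))
    (t-trans (≡⇒∼ (sym (LP.++-assoc X Y P')))
    (t-trans (t-++ (t-swap X Y) (t-refl {P'}))
    (t-trans (≡⇒∼ (LP.++-assoc Y X P'))
    (t-trans (t-++ (t-refl {Y}) (t-++ (t-refl {X}) (t-sym P∼P')))
    (t-trans (t-++ (t-refl {Y}) X+P∼0) (≡⇒∼ (LP.++-identityʳ Y))))))))

  ℕ-mul-across : ∀ n a y → ((a , ℤ-mul B (+ n) y) ∷ []) ∼ ((ℤ-mul A (+ n) a , y) ∷ [])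
  ℕ-mul-across zero    a y = t-trans (t-zeroʳ a) (t-sym (t-zeroˡ y))
  ℕ-mul-across (suc n) a y =
    t-trans (t-linʳ a y (ℤ-mul B (+ n) y))
    (t-trans (t-++ (t-refl {(a , y) ∷ []}) (ℕ-mul-across n a y))
    (t-sym (t-linˡ a (ℤ-mul A (+ n) a) y)))

  -- Negative scalars are moved by cancelling against the positive case.
  ℤ-mul-across : ∀ n a y → ((a , ℤ-mul B n y) ∷ []) ∼ ((ℤ-mul A n a , y) ∷ [])
  ℤ-mul-across (+ n)    a y = ℕ-mul-across n a y
  ℤ-mul-across -[1+ n ] a y =
    cancel ((a , B.⊝ z) ∷ []) ((A.⊝ a' , y) ∷ []) ((a , z) ∷ []) ((a' , y) ∷ []) (ℕ-mul-across (suc n) a y)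
      (t-trans (t-sym (t-linʳ a (B.⊝ z) z)) (t-trans (t-congʳ (B-inverseˡ z)) (t-zeroʳ a)))
      (t-trans (t-sym (t-linˡ (A.⊝ a') a' y)) (t-trans (t-congˡ (valA-injective inverse-val)) (t-zeroˡ y)))
    where
      z = ℤ-mul B (+ suc n) y
      a' = ℤ-mul A (+ suc n) a
      inverse-val : ∀ d → valA ((A.⊝ a') A.⊕ a') d ≡ valA A.0# d
      inverse-val d = trans (valA-⊕ _ _ d) (trans (cong (_+ valA a' d) (valA-⊝ a' d))
                        (trans (ℤP.+-inverseˡ (valA a' d)) (sym (valA-0 d))))

  distribute : ∀ a (L : List W) (g : W → B.C) → ((a , foldr (λ w r → g w B.⊕ r) B.0# L) ∷ []) ∼ map (λ w → (a , g w)) L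
  distribute a []      g = t-zeroʳ a
  distribute a (w ∷ L) g = t-trans (t-linʳ a (g w) _) (t-++ (t-refl {(a , g w) ∷ []}) (distribute a L g))

  map-cong : ∀ {p q : W → A.C × B.C} (L : List W) → (∀ w → (p w ∷ []) ∼ (q w ∷ [])) → map p L ∼ map q L
  map-cong []      h = t-refl
  map-cong (w ∷ L) h = t-++ (h w) (map-cong L h)

  expand-pure : ∀ a b → ((a , b) ∷ []) ∼ map (λ w → (ℤ-mul A (κ w b) a , e w)) LW
  expand-pure a b =
    t-trans (t-congʳ (B-expand b))
    (t-trans (distribute a LW (λ w → ℤ-mul B (κ w b) (e w))) (map-cong LW (λ w → ℤ-mul-across (κ w b) a (e w))))

  merge : (F G H : W → A.C) → (∀ w d → valA (H w) d ≡ valA (F w) d + valA (G w) d) → ∀ L →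
          (map (λ w → (F w , e w)) L ++ map (λ w → (G w , e w)) L) ∼ map (λ w → (H w , e w)) L
  merge F G H H≡F+G []      = t-refl
  merge F G H H≡F+G (w ∷ L) =
    t-trans (t-++ (t-refl {(F w , e w) ∷ []}) swap-head)
    (t-++ (t-trans (t-sym (t-linˡ (F w) (G w) (e w))) (t-congˡ (valA-injective (λ d → trans (valA-⊕ _ _ d) (sym (H≡F+G w d))))))
          (merge F G H H≡F+G L))
    where
      MF = map (λ w → (F w , e w)) L
      MG = map (λ w → (G w , e w)) L
      swap-head : (MF ++ ((G w , e w) ∷ MG)) ∼ ((G w , e w) ∷ (MF ++ MG))
      swap-head = t-trans (≡⇒∼ (sym (LP.++-assoc MF ((G w , e w) ∷ []) MG)))
                          (t-++ (t-swap MF ((G w , e w) ∷ [])) (t-refl {MG}))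

  zero-normal : (F : W → A.C) → (∀ w d → valA (F w) d ≡ 0ℤ) → ∀ L → [] ∼ map (λ w → (F w , e w)) L
  zero-normal F F≡0 []      = t-refl
  zero-normal F F≡0 (w ∷ L) = t-++ {[]} {(F w , e w) ∷ []} {[]}
    (t-sym (t-trans (t-congˡ (valA-injective (λ d → trans (F≡0 w d) (sym (valA-0 d))))) (t-zeroˡ (e w))))
    (zero-normal F F≡0 L)

  normal-form : ∀ L (F : W → A.C) → (∀ w d → valA (F w) d ≡ sumL L (λ p → κ w (proj₂ p) * valA (proj₁ p) d)) →
                L ∼ map (λ w → (F w , e w)) LW
  normal-form []            F hF = zero-normal F hF LW
  normal-form ((a , b) ∷ L) F hF =
    t-trans (t-++ {(a , b) ∷ []} (expand-pure a b) (normal-form L collect collect-val))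
    (merge (λ w → ℤ-mul A (κ w b) a) collect F
      (λ w d → trans (hF w d) (sym (cong₂ _+_ (val-ℤ-mul (κ w b) a d) (collect-val w d)))) LW)
    where
      collect : W → A.C
      collect w = linear-combination A L (λ p → κ w (proj₂ p)) proj₁
      collect-val : ∀ w d → valA (collect w) d ≡ sumL L (λ p → κ w (proj₂ p) * valA (proj₁ p) d)
      collect-val w = val-linear-combination L (λ p → κ w (proj₂ p)) proj₁

module HomologyRelation (X : Cx) where
  open Cx X

  _≈H_ : ∀ {i j} → CycCarrier X i j → CycCarrier X i j → Set
  _≈H_ {i} {j} = Ab._≈_ (Hom X i j)

  ≈H-pointwise : ∀ {i j} {x y : CycCarrier X i j} → (∀ b → proj₁ x b ≡ proj₁ y b) → x ≈H y
  ≈H-pointwise {x = x} {y} e = (λ _ → 0ℤ) , supp-0 , λ b →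
    trans (cong (λ z → z - proj₁ y b) (e b)) (trans (ℤP.+-inverseʳ (proj₁ y b)) (sym (app-0 enum coef b)))

  ≈H-refl : ∀ {i j} {x : CycCarrier X i j} → x ≈H x
  ≈H-refl {x = x} = ≈H-pointwise {x = x} {x} (λ b → refl)

  ≈H-sym : ∀ {i j} {x y : CycCarrier X i j} → x ≈H y → y ≈H x
  ≈H-sym {x = x} {y} (c , sc , x-y≡dc) = (λ b → - c b) , supp-neg sc , λ b →
    trans (a-b≡-[b-a] (proj₁ y b) (proj₁ x b)) (trans (cong -_ (x-y≡dc b)) (sym (app-neg enum coef c b)))
    where
      a-b≡-[b-a] : ∀ a b → a - b ≡ - (b - a)
      a-b≡-[b-a] = solve-∀

  ≈H-trans : ∀ {i j} {x y z : CycCarrier X i j} → x ≈H y → y ≈H z → x ≈H z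
  ≈H-trans {x = x} {y} {z} (c , sc , x-y≡dc) (c' , sc' , y-z≡dc') = (λ b → c b + c' b) , supp-+ sc sc' , λ b →
    trans (sym (ℤP.+-minus-telescope (proj₁ x b) (proj₁ y b) (proj₁ z b)))
          (trans (cong₂ _+_ (x-y≡dc b) (y-z≡dc' b)) (sym (app-+ enum coef c c' b)))

  ≈H-⊕ : ∀ {i j} {x x' y y' : CycCarrier X i j} → x ≈H x' → y ≈H y' →
         Ab._⊕_ (Hom X i j) x y ≈H Ab._⊕_ (Hom X i j) x' y'
  ≈H-⊕ {x = x} {x'} {y} {y'} (c , sc , x-x'≡dc) (c' , sc' , y-y'≡dc') = (λ b → c b + c' b) , supp-+ sc sc' , λ b →
    trans ([a+b]-[c+d]≡[a-c]+[b-d] (proj₁ x b) (proj₁ y b) (proj₁ x' b) (proj₁ y' b))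
          (trans (cong₂ _+_ (x-x'≡dc b) (y-y'≡dc' b)) (sym (app-+ enum coef c c' b)))
    where
      [a+b]-[c+d]≡[a-c]+[b-d] : ∀ a b c d → (a + b) - (c + d) ≡ (a - c) + (b - d)
      [a+b]-[c+d]≡[a-c]+[b-d] = solve-∀

module LinearFunctional {i : ℕ} (κ : (RB i → ℤ) → ℤ)
  (κ-cong : ∀ {y y' : RB i → ℤ} → (∀ r → y r ≡ y' r) → κ y ≡ κ y')
  (κ-lin : ∀ {A : Set} (L : List A) (c : A → ℤ) (f : A → RB i → ℤ) →
           κ (λ r → sumL L (λ p → c p * f p r)) ≡ sumL L (λ p → c p * κ (f p)))
  where

  κ-zero : ∀ {y} → (∀ r → y r ≡ 0ℤ) → κ y ≡ 0ℤ
  κ-zero y≡0 = trans (κ-cong y≡0) (κ-lin {⊤} [] (λ _ → 1ℤ) (λ _ _ → 0ℤ))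

  κ-+ : ∀ f g → κ (λ r → f r + g r) ≡ κ f + κ g
  κ-+ f g = trans (κ-cong (λ r → sym (two-terms (f r) (g r))))
            (trans (κ-lin (true ∷ false ∷ []) (λ _ → 1ℤ) (λ b → if b then f else g)) (two-terms (κ f) (κ g)))
    where
      two-terms : ∀ a b → 1ℤ * a + (1ℤ * b + 0ℤ) ≡ a + b
      two-terms = solve-∀

  κ-* : ∀ a f → κ (λ r → a * f r) ≡ a * κ f
  κ-* a f = trans (κ-cong (λ r → sym (ℤP.+-identityʳ (a * f r))))
            (trans (κ-lin (tt ∷ []) (λ _ → a) (λ _ → f)) (ℤP.+-identityʳ (a * κ f)))

  κ-neg : ∀ f → κ (λ r → - f r) ≡ - κ f
  κ-neg f = trans (κ-cong (λ r → sym (ℤP.-1*i≡-i (f r)))) (trans (κ-* (- 1ℤ) f) (ℤP.-1*i≡-i (κ f)))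

  κ-- : ∀ f g → κ (λ r → f r - g r) ≡ κ f - κ g
  κ-- f g = trans (κ-+ f (λ r → - g r)) (cong (_+_ (κ f)) (κ-neg g))

-- The chromatic differential is d̂ ⊗ Δ̄

Δ̄entry : ∀ {m n} → Vec Bool m → Vec Bool n → ℤ
Δ̄entry r r' = boolℤ (Δ̄coef (toList r) (toList r'))

sumL-resize : ∀ {m i} → m ≡ i → (g : Vec Bool m → ℤ) → sumL (allVecs m) g ≡ sumL (allVecs i) (λ r → g (resize m r))
sumL-resize refl g = sumL-cong (allVecs _) (λ r → cong g (sym (resize-id r)))

module FatgraphComplexes (F : Fatgraph) where
  open FG F

  d̃ : (TilB → ℤ) → TilB → ℤ
  d̃ = d tilCx

  d̂ : (HatB → ℤ) → HatB → ℤ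
  d̂ = d hatCx

  ht : HatB → ℕ
  ht s = h (HatB.st s)

  tilCoef-factorises : ∀ s r t r' → tilCoef (tb s r) (tb t r') ≡ hatCoef s t * Δ̄entry r r'
  tilCoef-factorises s r t r' =
    trans (sumℤ-map (allFin n) (λ j → S j * boolℤ (edgeHat j s t ∧ Δc)))
    (trans (sumL-cong (allFin n) {g = λ j → (S j * E j) * Δ̄entry r r'}
             (λ j → trans (cong (_*_ (S j)) (boolℤ-∧ (edgeHat j s t) Δc)) (sym (ℤP.*-assoc (S j) (E j) _))))
    (trans (sumL-*ʳ (allFin n) (Δ̄entry r r') (λ j → S j * E j))
           (cong (_* Δ̄entry r r') (sym (sumℤ-map (allFin n) (λ j → S j * E j))))))
    where
      Δc = Δ̄coef (toList r) (toList r')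
      S = sign (HatB.st s)
      E = λ j → boolℤ (edgeHat j s t)

  countTrue-delete : ∀ {m} (α : Vec Bool m) (j : Fin m) → lookup α j ≡ false → countTrue (α [ j ]≔ true) ≡ suc (countTrue α)
  countTrue-delete (false ∷ α) Fin.zero    e = refl
  countTrue-delete (true ∷ α)  (Fin.suc j) e = cong suc (countTrue-delete α j e)
  countTrue-delete (false ∷ α) (Fin.suc j) e = countTrue-delete α j e

  edgeHat-height : ∀ j s t → (ht t ≡ suc (ht s) → ⊥) → edgeHat j s t ≡ false
  edgeHat-height j s t ne =
    ∧∧-false (not (lookup (HatB.st s) j)) (eqL (toList (HatB.st t)) (toList (HatB.st s [ j ]≔ true))) _
      (λ present t≡s-j → ne (trans (cong countTrue (eqV-sound (HatB.st t) _ t≡s-j))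
                                    (countTrue-delete (HatB.st s) j (not-true present))))

  hatCoef-height : ∀ s t → (ht t ≡ suc (ht s) → ⊥) → hatCoef s t ≡ 0ℤ
  hatCoef-height s t ne =
    trans (sumℤ-map (allFin n) (λ j → sign (HatB.st s) j * boolℤ (edgeHat j s t)))
          (sumL-zero (allFin n) (λ j → trans (cong (λ b → sign (HatB.st s) j * boolℤ b) (edgeHat-height j s t ne))
                                             (ℤP.*-zeroʳ (sign (HatB.st s) j))))

  HatAtHeight : ℕ → (HatB → ℤ) → Set
  HatAtHeight i a = ∀ s → (ht s ≡ i → ⊥) → a s ≡ 0ℤ

  Supp⇒HatAtHeight : ∀ {i j a} → Supp (InDeg hatCx (+ i) j) a → HatAtHeight i a
  Supp⇒HatAtHeight sa s ne = [ (λ e → e) , (λ p → ⊥-elim (ne (ℤP.+-injective (proj₁ p)))) ]′ (sa s)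

  d̂-height : ∀ (g : HatB → ℤ) i → HatAtHeight i g → ∀ t → (ht t ≡ suc i → ⊥) → d̂ g t ≡ 0ℤ
  d̂-height g i g-at-i t ne = trans (app≡sumL allHat hatCoef g t) (sumL-zero allHat term)
    where
      term : ∀ s → hatCoef s t * g s ≡ 0ℤ
      term s = dec-elim (ht s ℕP.≟ i)
        (λ e → cong (_* g s) (hatCoef-height s t (λ e' → ne (trans e' (cong suc e)))))
        (λ ne' → trans (cong (_*_ (hatCoef s t)) (g-at-i s ne')) (ℤP.*-zeroʳ (hatCoef s t)))

  d̂-*ʳ : ∀ (g : HatB → ℤ) a t → d̂ (λ s → g s * a) t ≡ d̂ g t * a
  d̂-*ʳ g a t = trans (app≡sumL allHat hatCoef _ t)
    (trans (sumL-cong allHat (λ s → sym (ℤP.*-assoc (hatCoef s t) (g s) a)))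
    (trans (sumL-*ʳ allHat a (λ s → hatCoef s t * g s)) (cong (_* a) (sym (app≡sumL allHat hatCoef g t)))))

  slice : ∀ i → (TilB → ℤ) → RB i → HatB → ℤ
  slice i f r s = f (tb s (resize (ht s) r))

  AtHeight : ℕ → (TilB → ℤ) → Set
  AtHeight i f = ∀ s r → (ht s ≡ i → ⊥) → f (tb s r) ≡ 0ℤ

  Supp⇒AtHeight : ∀ {i j f} → Supp (InDeg tilCx (+ i) j) f → AtHeight i f
  Supp⇒AtHeight sf s r ne = [ (λ e → e) , (λ p → ⊥-elim (ne (ℤP.+-injective (proj₁ p)))) ]′ (sf (tb s r))

  column-sum : ∀ i f → AtHeight i f → ∀ s t r'' →
               sumL (map (tb s) (allVecs (ht s))) (λ x → tilCoef x (tb t r'') * f x)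
               ≡ sumL (allVecs i) (λ r → hatCoef s t * (Δ̄entry r r'' * slice i f r s))
  column-sum i f f-at-i s t r'' =
    trans (sumL-map (tb s) (allVecs (ht s)) (λ x → tilCoef x (tb t r'') * f x)) (dec-elim (ht s ℕP.≟ i) at-i off-i)
    where
      at-i : ht s ≡ i → _
      at-i e = trans (sumL-resize e (λ r → tilCoef (tb s r) (tb t r'') * f (tb s r)))
        (sumL-cong (allVecs i) (λ r →
          trans (cong (_* f (tb s (resize (ht s) r))) (tilCoef-factorises s (resize (ht s) r) t r''))
          (trans (ℤP.*-assoc (hatCoef s t) _ _)
          (cong (λ l → hatCoef s t * (boolℤ (Δ̄coef l (toList r'')) * slice i f r s)) (toList-resize (ht s) r (sym e))))))
      off-i : (ht s ≡ i → ⊥) → _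
      off-i ne =
        trans (sumL-zero (allVecs (ht s)) (λ r → trans (cong (_*_ (tilCoef (tb s r) (tb t r''))) (f-at-i s r ne))
                                                       (ℤP.*-zeroʳ (tilCoef (tb s r) (tb t r'')))))
        (sym (sumL-zero (allVecs i) (λ r → trans (cong (λ z → hatCoef s t * (Δ̄entry r r'' * z)) (f-at-i s _ ne))
                 (trans (cong (_*_ (hatCoef s t)) (ℤP.*-zeroʳ (Δ̄entry r r''))) (ℤP.*-zeroʳ (hatCoef s t))))))

  d̃-slices : ∀ i f → AtHeight i f → ∀ t r'' →
             d̃ f (tb t r'') ≡ sumL (allVecs i) (λ r → Δ̄entry r r'' * d̂ (slice i f r) t)
  d̃-slices i f f-at-i t r'' =
    trans (app≡sumL allTil tilCoef f (tb t r''))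
    (trans (sumL-concatMap (λ b → map (tb b) (allVecs _)) allHat (λ x → tilCoef x (tb t r'') * f x))
    (trans (sumL-cong allHat (λ s → column-sum i f f-at-i s t r''))
    (trans (sumL-swap allHat (allVecs i) (λ s r → hatCoef s t * (Δ̄entry r r'' * slice i f r s)))
    (sumL-cong (allVecs i) (λ r →
       trans (sumL-cong allHat (λ s → x∙yz≈y∙xz (hatCoef s t) (Δ̄entry r r'') (slice i f r s)))
       (trans (sumL-*ˡ allHat (Δ̄entry r r'') (λ s → hatCoef s t * slice i f r s))
       (cong (_*_ (Δ̄entry r r'')) (sym (app≡sumL allHat hatCoef (slice i f r) t)))))))))

  _⊗ᶠ_ : ∀ {i} → (HatB → ℤ) → (RB i → ℤ) → TilB → ℤ
  _⊗ᶠ_ {i} a b y = a (TilB.hp y) * b (resize i (TilB.rl y))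

  ⊗ᶠ-at-height : ∀ {i} (a : HatB → ℤ) (b : RB i → ℤ) → HatAtHeight i a → AtHeight i (a ⊗ᶠ b)
  ⊗ᶠ-at-height {i} a b a-at-i s r ne = cong (_* b (resize i r)) (a-at-i s ne)

  slice-⊗ᶠ : ∀ {i} (a : HatB → ℤ) (b : RB i → ℤ) → HatAtHeight i a → ∀ r s → slice i (a ⊗ᶠ b) r s ≡ a s * b r
  slice-⊗ᶠ {i} a b a-at-i r s = dec-elim (ht s ℕP.≟ i)
    (λ e → cong (λ u → a s * b u) (resize-resize r (sym e)))
    (λ ne → trans (cong (_* b (resize i (resize (ht s) r))) (a-at-i s ne)) (sym (cong (_* b r) (a-at-i s ne))))

  d̃-⊗ᶠ : ∀ {i} (a : HatB → ℤ) (b : RB i → ℤ) → HatAtHeight i a →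
         ∀ t r'' → d̃ (a ⊗ᶠ b) (tb t r'') ≡ d̂ a t * sumL (allVecs i) (λ r → Δ̄entry r r'' * b r)
  d̃-⊗ᶠ {i} a b a-at-i t r'' =
    trans (d̃-slices i (a ⊗ᶠ b) (⊗ᶠ-at-height a b a-at-i) t r'')
    (trans (sumL-cong (allVecs i) (λ r →
             trans (cong (_*_ (Δ̄entry r r'')) (trans (app-cong allHat hatCoef (slice-⊗ᶠ a b a-at-i r) t) (d̂-*ʳ a (b r) t)))
                   (x∙yz≈y∙xz (Δ̄entry r r'') (d̂ a t) (b r))))
           (sumL-*ˡ (allVecs i) (d̂ a t) (λ r → Δ̄entry r r'' * b r)))

  ⊗ᶠ-supp : ∀ {i p q} (a : HatB → ℤ) (b : RB i → ℤ) → Supp (InDeg hatCx (+ i) p) a → Supp (RDeg i q) b →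
            Supp (InDeg tilCx (+ i) (p + q)) (a ⊗ᶠ b)
  ⊗ᶠ-supp {i} a b sa sb (tb s r) with sa s | sb (resize i r)
  ... | inj₁ a≡0 | _ = inj₁ (cong (_* b (resize i r)) a≡0)
  ... | inj₂ _ | inj₁ b≡0 = inj₁ (trans (cong (_*_ (a s)) b≡0) (ℤP.*-zeroʳ (a s)))
  ... | inj₂ (hs≡i , ds≡p) | inj₂ dr≡q =
    inj₂ (hs≡i , cong₂ _+_ ds≡p (trans (cong rdegL (sym (toList-resize i r (ℤP.+-injective hs≡i)))) dr≡q))

  -- Δ̄ᵢ is injective, so the slices of a d̃-cycle are d̂-cycles.
  slice-cycle : ∀ i j (x : CycCarrier tilCx (+ i) j) → ∀ r t → d̂ (slice i (proj₁ x) r) t ≡ 0ℤ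
  slice-cycle i j (f , sf , cf) r t = dec-elim (ht t ℕP.≟ suc i) at-suc-i
      (λ ne → d̂-height (slice i f r) i (λ s → Supp⇒AtHeight sf s _) t ne)
    where
      r'' = resize (ht t) (r ∷ʳ true)
      at-suc-i : ht t ≡ suc i → d̂ (slice i f r) t ≡ 0ℤ
      at-suc-i e = sym (trans (sym (cf (tb t r'')))
        (trans (d̃-slices i f (Supp⇒AtHeight sf) t r'')
        (trans (sumL-cong (allVecs i) {g = λ r₀ → boolℤ (eqV r₀ r) * d̂ (slice i f r₀) t}
                  (λ r₀ → cong (λ l → boolℤ l * d̂ (slice i f r₀) t)
                     (trans (cong (Δ̄coef (toList r₀)) (toList-resize (ht t) (r ∷ʳ true) (sym e))) (Δ̄coef-∷ʳ-x₀ r₀ r))))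
        (sumL-δ i (λ r₀ → d̂ (slice i f r₀) t) r))))

  -- The facts about d̃ that the decomposition uses; they are proved separately for i = 0 and i > 0.
  record BoundaryTransfer (i : ℕ) (L : SplitBasis i) : Set where
    open SplitBasis L
    field
      image-boundary : ∀ (c : TilB → ℤ) j' → Supp (InDeg tilCx (+ i - 1ℤ) j') c → ∀ w →
        Σ (HatB → ℤ) λ cw → Supp (InDeg hatCx (+ i - 1ℤ) (j' - dI w)) cw
                          × (∀ t → κI w (λ r → slice i (d̃ c) r t) ≡ d̂ cw t)
      complement-vanishes : ∀ (c : TilB → ℤ) j' → Supp (InDeg tilCx (+ i - 1ℤ) j') c →
        ∀ w t → κQ w (λ r → slice i (d̃ c) r t) ≡ 0ℤ
      boundary-lift : ∀ (c : HatB → ℤ) p q (b : RB i → ℤ) →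
        Supp (InDeg hatCx (+ i - 1ℤ) p) c → Supp (RDeg i q) b → InIm i b →
        Σ (TilB → ℤ) λ C → Supp (InDeg tilCx (+ i - 1ℤ) (p + q)) C × (∀ s r → d̂ c s * b (resize i r) ≡ d̃ C (tb s r))

module BoundaryTransfers (F : Fatgraph) where
  open FG F
  open FatgraphComplexes F

  module Suc (k : ℕ) where
    open SplitBasisSuc k using (κQ; κQ-im; splitBasis)

    module _ (c : TilB → ℤ) (c-at-k : AtHeight k c) (t : HatB) (v : RB (suc k)) where
      d̃-at-height : ht t ≡ suc k → d̃ c (tb t (resize (ht t) v)) ≡ Δ̄sumL k (λ r → d̂ (slice k c r) t) v
      d̃-at-height e = trans (d̃-slices k c c-at-k t _) (sumL-cong (allVecs k)
        (λ r → cong (λ l → boolℤ (Δ̄coef (toList r) l) * d̂ (slice k c r) t) (toList-resize (ht t) v (sym e))))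

      d̃-off-height : (ht t ≡ suc k → ⊥) → d̃ c (tb t (resize (ht t) v)) ≡ 0ℤ
      d̃-off-height ne = trans (d̃-slices k c c-at-k t _) (sumL-zero (allVecs k) (λ r →
        cong (λ b → boolℤ b * d̂ (slice k c r) t) (Δ̄coef-length-mismatch (toList r) _
          (λ eq → ne (trans (sym (VP.length-toList (resize (ht t) v))) (trans eq (cong suc (VP.length-toList r))))))))

    -- The x₀-coordinates of d̃ c are the d̂-boundaries of the slices of c.
    image-boundary : ∀ (c : TilB → ℤ) j' → Supp (InDeg tilCx (+ k) j') c → ∀ w →
      Σ (HatB → ℤ) λ cw → Supp (InDeg hatCx (+ k) (j' - rdegL (toList w))) cw
                        × (∀ t → slice (suc k) (d̃ c) (w ∷ʳ true) t ≡ d̂ cw t)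
    image-boundary c j' sc w = slice k c w , slice-supp , slice-boundary
      where
        slice-supp : Supp (InDeg hatCx (+ k) (j' - rdegL (toList w))) (slice k c w)
        slice-supp s = [ inj₁ , (λ { (hs≡k , deg≡j') → inj₂ (hs≡k , m+n≡j⇒m≡j-n (trans (cong (λ l → hatDeg s + rdegL l)
                          (sym (toList-resize (ht s) w (sym (ℤP.+-injective hs≡k))))) deg≡j')) }) ]′ (sc (tb s (resize (ht s) w)))
          where
            m+n≡j⇒m≡j-n : ∀ {a b j} → a + b ≡ j → a ≡ j - b
            m+n≡j⇒m≡j-n {a} {b} e = trans (sym ([m+n]-n≡m a b)) (cong (_- b) e)
        slice-boundary : ∀ t → slice (suc k) (d̃ c) (w ∷ʳ true) t ≡ d̂ (slice k c w) t
        slice-boundary t = dec-elim (ht t ℕP.≟ suc k)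
          (λ e → trans (d̃-at-height c (Supp⇒AtHeight sc) t (w ∷ʳ true) e) (Δ̄sumL-∷ʳ-x₀ k _ w))
          (λ ne → trans (d̃-off-height c (Supp⇒AtHeight sc) t (w ∷ʳ true) ne)
                        (sym (d̂-height (slice k c w) k (λ s → Supp⇒AtHeight sc s _) t ne)))

    complement-vanishes : ∀ (c : TilB → ℤ) j' → Supp (InDeg tilCx (+ k) j') c → ∀ w t →
                          κQ w (λ r → slice (suc k) (d̃ c) r t) ≡ 0ℤ
    complement-vanishes c j' sc w t = κQ-im w _ (dec-elim (ht t ℕP.≟ suc k) at-height off-height)
      where
        at-height : ht t ≡ suc k → InIm (suc k) (λ r → slice (suc k) (d̃ c) r t)
        at-height e = (λ r → d̂ (slice k c r) t) , λ r →
          trans (d̃-at-height c (Supp⇒AtHeight sc) t r e) (sym (Δ̄app≡Δ̄sumL k _ r))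
        off-height : (ht t ≡ suc k → ⊥) → InIm (suc k) (λ r → slice (suc k) (d̃ c) r t)
        off-height ne = (λ _ → 0ℤ) , λ r →
          trans (d̃-off-height c (Supp⇒AtHeight sc) t r ne) (sym (app-0 (allVecs k) _ r))

    -- d̂ c ⊗ Δ̄(x) = d̃ (c ⊗ x), where x is read off from the x₀-coordinates of b = Δ̄(x).
    boundary-lift : ∀ (c : HatB → ℤ) p q (b : RB (suc k) → ℤ) →
      Supp (InDeg hatCx (+ k) p) c → Supp (RDeg (suc k) q) b → InIm (suc k) b →
      Σ (TilB → ℤ) λ C → Supp (InDeg tilCx (+ k) (p + q)) C × (∀ s r → d̂ c s * b (resize (suc k) r) ≡ d̃ C (tb s r))
    boundary-lift c p q b sc sb (x , b≡Δ̄x) = c ⊗ᶠ x' , ⊗ᶠ-supp c x' sc x'-supp , lifted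
      where
        x' : RB k → ℤ
        x' u = b (u ∷ʳ true)
        x'≡x : ∀ u → x' u ≡ x u
        x'≡x u = trans (b≡Δ̄x (u ∷ʳ true)) (trans (Δ̄app≡Δ̄sumL k x _) (Δ̄sumL-∷ʳ-x₀ k x u))
        x'-supp : Supp (RDeg k q) x'
        x'-supp u = [ inj₁ , (λ e → inj₂ (trans (sym (rdeg-∷ʳ-x₀ u)) e)) ]′ (sb (u ∷ʳ true))
        c-at-k = Supp⇒HatAtHeight sc
        lifted : ∀ s r → d̂ c s * b (resize (suc k) r) ≡ d̃ (c ⊗ᶠ x') (tb s r)
        lifted s r = sym (trans (d̃-⊗ᶠ c x' c-at-k s r) (dec-elim (ht s ℕP.≟ suc k)
          (λ e → cong (_*_ (d̂ c s))
             (trans (sumL-cong (allVecs k) (λ u → cong₂ (λ l v → boolℤ (Δ̄coef (toList u) l) * v)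
                                                        (sym (toList-resize (suc k) r e)) (x'≡x u)))
                    (trans (sym (Δ̄app≡Δ̄sumL k x _)) (sym (b≡Δ̄x _)))))
          (λ ne → trans (cong (_* sumL (allVecs k) (λ u → Δ̄entry u r * x' u)) (d̂-height c k c-at-k s ne))
                        (sym (cong (_* b (resize (suc k) r)) (d̂-height c k c-at-k s ne))))))

    transfer : BoundaryTransfer (suc k) splitBasis
    transfer = record
      { image-boundary = image-boundary ; complement-vanishes = complement-vanishes ; boundary-lift = boundary-lift }

  chains-below-zero-vanish : ∀ {B : Set} (hgt : B → ℕ) (deg : B → ℤ) j' (c : B → ℤ) →
                             Supp (λ b → + hgt b ≡ -[1+ 0 ] × deg b ≡ j') c → ∀ b → c b ≡ 0ℤ
  chains-below-zero-vanish hgt deg j' c sc b = [ (λ e → e) , (λ { (() , _) }) ]′ (sc b)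

  transfer0 : BoundaryTransfer 0 splitBasis0
  transfer0 = record
    { image-boundary = λ c j' sc ()
    ; complement-vanishes = λ c j' sc w t →
        app-zero allTil tilCoef (chains-below-zero-vanish (λ y → ht (TilB.hp y)) tilDeg j' c sc) _
    ; boundary-lift = λ c p q b sc sb ib → (λ _ → 0ℤ) , supp-0 , λ s r →
        trans (cong (_* b []) (app-zero allHat hatCoef (chains-below-zero-vanish ht hatDeg p c sc) s))
              (sym (app-0 allTil tilCoef (tb s r))) }

-- The summand indexed by m ∈ upTo (2i + 1) of the right-hand side lives in internal degree -m.
qOf : ℕ → ℤ
qOf m = - (+ m)

qOf-injective : ∀ {m m'} → qOf m ≡ qOf m' → m ≡ m'
qOf-injective e = ℤP.+-injective (ℤP.neg-injective e)

sumL-keep-if-∉ : ∀ {ms c} (a g : ℤ) → All (c ≢_) ms → a ≡ qOf c → sumL ms (λ m → keep-if (a ℤP.≟ qOf m) g) ≡ 0ℤ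
sumL-keep-if-∉         a g []              a≡qc = refl
sumL-keep-if-∉ {m ∷ _} a g (c≢m ∷ c∉ms) a≡qc with a ℤP.≟ qOf m
... | yes a≡qm = ⊥-elim (c≢m (qOf-injective (trans (sym a≡qc) a≡qm)))
... | no _     = trans (ℤP.+-identityˡ _) (sumL-keep-if-∉ a g c∉ms a≡qc)

sumL-keep-if-∈ : ∀ {ms c} (a g : ℤ) → Unique ms → c ∈ ms → a ≡ qOf c → sumL ms (λ m → keep-if (a ℤP.≟ qOf m) g) ≡ g
sumL-keep-if-∈ {c ∷ _} a g (c∉ms ∷ _) (here refl) a≡qc with a ℤP.≟ qOf c
... | yes _ = trans (cong (_+_ g) (sumL-keep-if-∉ a g c∉ms a≡qc)) (ℤP.+-identityʳ g)
... | no a≢qc = ⊥-elim (a≢qc a≡qc)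
sumL-keep-if-∈ {m ∷ _} a g (m∉ms ∷ u) (there c∈ms) a≡qc with a ℤP.≟ qOf m
... | yes a≡qm = ⊥-elim (All.lookup m∉ms c∈ms (qOf-injective (trans (sym a≡qm) a≡qc)))
... | no _     = trans (ℤP.+-identityˡ _) (sumL-keep-if-∈ a g u c∈ms a≡qc)

-- The isomorphism in a fixed bidegree

module Decomposition (F : Fatgraph) (i : ℕ) (L : SplitBasis i)
                     (TL : FatgraphComplexes.BoundaryTransfer F i L) (j : ℤ) where
  open FG F
  open FatgraphComplexes F
  open SplitBasis L
  open BoundaryTransfer TL
  module HT = HomologyRelation tilCx
  module HH = HomologyRelation hatCx
  module LinI (w : I) = LinearFunctional (κI w) (κI-cong w) (κI-lin w)
  module LinQ (w : J) = LinearFunctional (κQ w) (κQ-cong w) (κQ-lin w)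

  Ẑ : ℤ → Set
  Ẑ q = CycCarrier hatCx (+ i) (j - q)

  Z̃ : Set
  Z̃ = CycCarrier tilCx (+ i) j

  _⊕̃_ : Z̃ → Z̃ → Z̃
  _⊕̃_ = Ab._⊕_ (Cyc tilCx (+ i) j)

  0̃ : Z̃
  0̃ = Ab.0# (Cyc tilCx (+ i) j)

  _≈̃_ : Z̃ → Z̃ → Set
  _≈̃_ = Ab._≈_ (Hom tilCx (+ i) j)

  ≈̃-pointwise : ∀ (x y : Z̃) → (∀ b → proj₁ x b ≡ proj₁ y b) → x ≈̃ y
  ≈̃-pointwise x y = HT.≈H-pointwise {+ i} {j} {x} {y}

  Summand : ℕ → Ab
  Summand m = (Hom hatCx (+ i) (j - qOf m) ⊗ ImAb i (qOf m)) ⊞ (Cyc hatCx (+ i) (j - qOf m) ⊗ QuotAb i (qOf m))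

  degrees : List ℕ
  degrees = upTo (suc (2 ℕ.* i))

  Sum≈ : (ms : List ℕ) → Ab.C (⨁ ms Summand) → Ab.C (⨁ ms Summand) → Set
  Sum≈ ms = Ab._≈_ (⨁ ms Summand)

  slice-supp : ∀ (x : Z̃) s → ht s ≡ i → Supp (RDeg i (j - hatDeg s)) (λ r → slice i (proj₁ x) r s)
  slice-supp (f , sf , _) s hs≡i r =
    [ inj₁ , (λ { (_ , deg≡j) → inj₂ (a+b≡j⇒b≡j-a (trans (cong (λ l → hatDeg s + rdegL l)
                                         (sym (toList-resize (ht s) r (sym hs≡i)))) deg≡j)) }) ]′
      (sf (tb s (resize (ht s) r)))
    where
      a+b≡j⇒b≡j-a : ∀ {a b j} → a + b ≡ j → b ≡ j - a
      a+b≡j⇒b≡j-a {a} {b} e = trans (sym (a+b-a≡b a b)) (cong (_- a) e)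
        where
          a+b-a≡b : ∀ a b → (a + b) - a ≡ b
          a+b-a≡b = solve-∀

  -- The coordinates of a cycle of C̃ along a family of homogeneous functionals κ on R^{⊗i},
  -- kept only in internal degree qOf m.
  module Coordinates (K : Set) (κ : K → (RB i → ℤ) → ℤ) (dK : K → ℤ)
    (κ-cong : ∀ w {y y' : RB i → ℤ} → (∀ r → y r ≡ y' r) → κ w y ≡ κ w y')
    (κ-lin : ∀ w {A : Set} (L : List A) (c : A → ℤ) (f : A → RB i → ℤ) →
             κ w (λ r → sumL L (λ p → c p * f p r)) ≡ sumL L (λ p → c p * κ w (f p)))
    (κ-deg : ∀ w q y → Supp (RDeg i q) y → (q ≡ dK w → ⊥) → κ w y ≡ 0ℤ)
    where
    module Lin (w : K) = LinearFunctional (κ w) (κ-cong w) (κ-lin w)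

    coord : K → (TilB → ℤ) → HatB → ℤ
    coord w f s = κ w (λ r → slice i f r s)

    coord-cycle : ∀ w q (x : Z̃) → dK w ≡ q → IsCycle hatCx (+ i) (j - q) (coord w (proj₁ x))
    coord-cycle w q (f , sf , cf) dw≡q = coord-supp , coord-closed
      where
        coord-supp : Supp (InDeg hatCx (+ i) (j - q)) (coord w f)
        coord-supp s = dec-elim (ht s ℕP.≟ i)
          (λ hs≡i → dec-elim (hatDeg s ℤP.≟ (j - q))
             (λ ds≡j-q → inj₂ (cong +_ hs≡i , ds≡j-q))
             (λ ds≢j-q → inj₁ (κ-deg w (j - hatDeg s) _ (slice-supp (f , sf , cf) s hs≡i)
                                 (λ e → ds≢j-q (j-a≡q⇒a≡j-q (trans e dw≡q))))))
          (λ hs≢i → inj₁ (Lin.κ-zero w (λ r → Supp⇒AtHeight sf s _ hs≢i)))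
          where
            j-a≡q⇒a≡j-q : ∀ {a q} → j - a ≡ q → a ≡ j - q
            j-a≡q⇒a≡j-q {a} e = trans (sym (j-[j-a]≡a a j)) (cong (_-_ j) e)
              where
                j-[j-a]≡a : ∀ a j → j - (j - a) ≡ a
                j-[j-a]≡a = solve-∀
        coord-closed : ∀ t → d̂ (coord w f) t ≡ 0ℤ
        coord-closed t = trans (app≡sumL allHat hatCoef (coord w f) t)
          (trans (sym (κ-lin w allHat (λ s → hatCoef s t) (λ s r → slice i f r s)))
          (Lin.κ-zero w (λ r → trans (sym (app≡sumL allHat hatCoef (slice i f r) t)) (slice-cycle i j (f , sf , cf) r t))))

    coord-in : ∀ w q → Dec (dK w ≡ q) → Z̃ → Ẑ q
    coord-in w q (yes dw≡q) x = coord w (proj₁ x) , coord-cycle w q x dw≡q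
    coord-in w q (no _)     x = (λ _ → 0ℤ) , cyc-0 hatCx

    coordAt : (m : ℕ) → K → Z̃ → Ẑ (qOf m)
    coordAt m w x = coord-in w (qOf m) (dK w ℤP.≟ qOf m) x

    coordAt-val : ∀ m w x s → proj₁ (coordAt m w x) s ≡ keep-if (dK w ℤP.≟ qOf m) (coord w (proj₁ x) s)
    coordAt-val m w x s with dK w ℤP.≟ qOf m
    ... | yes _ = refl
    ... | no _  = refl


    coordAt-⊕ : ∀ m w x y s → proj₁ (coordAt m w (x ⊕̃ y)) s ≡ proj₁ (coordAt m w x) s + proj₁ (coordAt m w y) s
    coordAt-⊕ m w x y s =
      trans (coordAt-val m w (x ⊕̃ y) s)
      (trans (cong (keep-if (dK w ℤP.≟ qOf m)) (Lin.κ-+ w _ _))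
      (trans (keep-if-+ (dK w ℤP.≟ qOf m) _ _) (sym (cong₂ _+_ (coordAt-val m w x s) (coordAt-val m w y s)))))

  module CI = Coordinates I κI dI κI-cong κI-lin κI-deg
  module CQ = Coordinates J κQ dQ κQ-cong κQ-lin κQ-deg

  image-basis-in : ∀ w q → Dec (dI w ≡ q) → Ab.C (ImAb i q)
  image-basis-in w q (yes dw≡q) = eI w , subst (λ q' → Supp (RDeg i q') (eI w)) dw≡q (eI-deg w) , eI-im w
  image-basis-in w q (no _)     = (λ _ → 0ℤ) , supp-0 , inIm-0 i

  image-basis : (m : ℕ) → I → Ab.C (ImAb i (qOf m))
  image-basis m w = image-basis-in w (qOf m) (dI w ℤP.≟ qOf m)

  image-basis-val : ∀ m w r → proj₁ (image-basis m w) r ≡ keep-if (dI w ℤP.≟ qOf m) (eI w r)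
  image-basis-val m w r with dI w ℤP.≟ qOf m
  ... | yes _ = refl
  ... | no _  = refl

  quot-basis-in : ∀ w q → Dec (dQ w ≡ q) → Ab.C (QuotAb i q)
  quot-basis-in w q (yes dw≡q) = eQ w , subst (λ q' → Supp (RDeg i q') (eQ w)) dw≡q (eQ-deg w)
  quot-basis-in w q (no _)     = (λ _ → 0ℤ) , supp-0

  quot-basis : (m : ℕ) → J → Ab.C (QuotAb i (qOf m))
  quot-basis m w = quot-basis-in w (qOf m) (dQ w ℤP.≟ qOf m)

  -- The projection of R^{⊗i} onto the complement of Im Δ̄ along Im Δ̄.
  Qpart : (RB i → ℤ) → RB i → ℤ
  Qpart y r = sumL LJ (λ w → κQ w y * eQ w r)

  Qpart-supp : ∀ q y → Supp (RDeg i q) y → Supp (RDeg i q) (Qpart y)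
  Qpart-supp q y sy = supp-sumL LJ (λ w r → κQ w y * eQ w r) term
    where
      term : ∀ w → Supp (RDeg i q) (λ r → κQ w y * eQ w r)
      term w r = dec-elim (q ℤP.≟ dQ w)
        (λ q≡dw → [ (λ e → inj₁ (trans (cong (_*_ (κQ w y)) e) (ℤP.*-zeroʳ (κQ w y))))
                  , (λ e → inj₂ (trans e (sym q≡dw))) ]′ (eQ-deg w r))
        (λ q≢dw → inj₁ (cong (_* eQ w r) (κQ-deg w q y sy q≢dw)))

  Qpart-cong : ∀ (y y' : RB i → ℤ) → InIm i (λ r → y r - y' r) → ∀ r → Qpart y r ≡ Qpart y' r
  Qpart-cong y y' im r = sumL-cong LJ (λ w → cong (_* eQ w r)
    (ℤP.i-j≡0⇒i≡j (κQ w y) (κQ w y') (trans (sym (LinQ.κ-- w y y')) (κQ-im w _ im))))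

  Qpart-+ : ∀ (y y' : RB i → ℤ) r → Qpart (λ r' → y r' + y' r') r ≡ Qpart y r + Qpart y' r
  Qpart-+ y y' r =
    trans (sumL-cong LJ (λ w → trans (cong (_* eQ w r) (LinQ.κ-+ w y y')) (ℤP.*-distribʳ-+ (eQ w r) (κQ w y) (κQ w y'))))
          (sumL-+ LJ (λ w → κQ w y * eQ w r) (λ w → κQ w y' * eQ w r))

  Qpart-0 : ∀ r → Qpart (λ _ → 0ℤ) r ≡ 0ℤ
  Qpart-0 r = sumL-zero LJ (λ w → cong (_* eQ w r) (LinQ.κ-zero w (λ _ → refl)))

  κI-Qpart : ∀ w y → κI w (Qpart y) ≡ 0ℤ
  κI-Qpart w y = trans (κI-lin w LJ (λ v → κQ v y) eQ)
    (sumL-zero LJ (λ v → trans (cong (_*_ (κQ v y)) (κI-eQ w v)) (ℤP.*-zeroʳ (κQ v y))))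

  κQ-Qpart : ∀ w y → κQ w (Qpart y) ≡ κQ w y
  κQ-Qpart w y = trans (κQ-lin w LJ (λ v → κQ v y) eQ)
    (trans (sumL-cong LJ (λ v → trans (cong (_*_ (κQ v y)) (κQ-eQ w v)) (ℤP.*-comm (κQ v y) (boolℤ (eqJ w v)))))
           (sumJ-δ (λ v → κQ v y) w))

  Qpart-quot-basis : ∀ m w r → Qpart (proj₁ (quot-basis m w)) r ≡ keep-if (dQ w ℤP.≟ qOf m) (eQ w r)
  Qpart-quot-basis m w r with dQ w ℤP.≟ qOf m
  ... | yes _ = trans (sumL-cong LJ (λ v → cong (_* eQ v r) (κQ-eQ v w))) (sumJ-δ′ (λ v → eQ v r) w)
  ... | no _  = Qpart-0 r

  module EvalIm (q : ℤ) = Evaluation (ImAb i q) proj₁ (λ _ _ _ → refl) (λ _ → refl) (λ _ _ → refl)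
  module EvalQuot (q : ℤ) = Evaluation (QuotAb i q) proj₁ (λ _ _ _ → refl) (λ _ → refl) (λ _ _ → refl)

  expand-image : ∀ m (b : Ab.C (ImAb i (qOf m))) →
    Ab._≈_ (ImAb i (qOf m)) b (linear-combination (ImAb i (qOf m)) LI (λ w → κI w (proj₁ b)) (image-basis m))
  expand-image m (y , sy , y-im) r =
    trans (expand y r)
    (trans (cong₂ _+_ (sumL-cong LI term) (sumL-zero LJ (λ w → cong (_* eQ w r) (κQ-im w y y-im))))
    (trans (ℤP.+-identityʳ _) (sym (EvalIm.val-linear-combination (qOf m) LI (λ w → κI w y) (image-basis m) r))))
    where
      term : ∀ w → κI w y * eI w r ≡ κI w y * proj₁ (image-basis m w) r
      term w with dI w ℤP.≟ qOf m
      ... | yes _ = refl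
      ... | no dw≢q = trans (cong (_* eI w r) (κI-deg w (qOf m) y sy (λ e → dw≢q (sym e)))) (sym (ℤP.*-zeroʳ (κI w y)))

  expand-quot : ∀ m (b : Ab.C (QuotAb i (qOf m))) →
    Ab._≈_ (QuotAb i (qOf m)) b (linear-combination (QuotAb i (qOf m)) LJ (λ w → κQ w (proj₁ b)) (quot-basis m))
  expand-quot m (y , sy) = InIm-cong i (λ r → cong (_-_ (y r))
      (sym (trans (EvalQuot.val-linear-combination (qOf m) LJ (λ w → κQ w y) (quot-basis m) r) (sumL-cong LJ (term r)))))
      (y-Qpart-im y)
    where
      term : ∀ r w → κQ w y * proj₁ (quot-basis m w) r ≡ κQ w y * eQ w r
      term r w with dQ w ℤP.≟ qOf m
      ... | yes _ = refl
      ... | no dw≢q = trans (ℤP.*-zeroʳ (κQ w y)) (sym (cong (_* eQ w r) (κQ-deg w (qOf m) y sy (λ e → dw≢q (sym e)))))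

  module TensorI (m : ℕ) = TensorOverBasis (Hom hatCx (+ i) (j - qOf m)) (ImAb i (qOf m))
    proj₁ (λ _ _ _ → refl) (λ _ → refl) (λ _ _ → refl)
    (λ {x} {y} → HH.≈H-pointwise {+ i} {j - qOf m} {x} {y}) (λ z r → ℤP.+-inverseˡ (proj₁ z r))
    LI (image-basis m) (λ w b → κI w (proj₁ b)) (expand-image m)

  module TensorQ (m : ℕ) = TensorOverBasis (Cyc hatCx (+ i) (j - qOf m)) (QuotAb i (qOf m))
    proj₁ (λ _ _ _ → refl) (λ _ → refl) (λ _ _ → refl)
    (λ e → e) (λ z → InIm-cong i (λ r → sym (trans (ℤP.+-identityʳ _) (ℤP.+-inverseˡ (proj₁ z r)))) (inIm-0 i))
    LJ (quot-basis m) (λ w b → κQ w (proj₁ b)) (expand-quot m)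

  toSummand : (m : ℕ) → Z̃ → Ab.C (Summand m)
  toSummand m x = map (λ w → CI.coordAt m w x , image-basis m w) LI , map (λ w → CQ.coordAt m w x , quot-basis m w) LJ

  toSum : (ms : List ℕ) → Z̃ → Ab.C (⨁ ms Summand)
  toSum []       x = tt
  toSum (m ∷ ms) x = toSummand m x , toSum ms x

  toSum-⊕ : ∀ ms x y → Sum≈ ms (toSum ms (x ⊕̃ y)) (Ab._⊕_ (⨁ ms Summand) (toSum ms x) (toSum ms y))
  toSum-⊕ []       x y = tt
  toSum-⊕ (m ∷ ms) x y =
    ( Tensor.t-sym (TensorI.merge m (λ w → CI.coordAt m w x) (λ w → CI.coordAt m w y) (λ w → CI.coordAt m w (x ⊕̃ y))
                                    (λ w → CI.coordAt-⊕ m w x y) LI)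
    , Tensor.t-sym (TensorQ.merge m (λ w → CQ.coordAt m w x) (λ w → CQ.coordAt m w y) (λ w → CQ.coordAt m w (x ⊕̃ y))
                                    (λ w → CQ.coordAt-⊕ m w x y) LJ) )
    , toSum-⊕ ms x y

  image-coord-cong : ∀ {x x'} → x ≈̃ x' → ∀ w q (dec : Dec (dI w ≡ q)) →
                     HH._≈H_ {+ i} {j - q} (CI.coord-in w q dec x) (CI.coord-in w q dec x')
  image-coord-cong (c , sc , x-x'≡dc) w q (yes dw≡q) =
    cw , subst (λ q' → Supp (InDeg hatCx (+ i - 1ℤ) (j - q')) cw) dw≡q scw , λ s →
      trans (sym (LinI.κ-- w _ _)) (trans (κI-cong w (λ r → x-x'≡dc (tb s (resize (ht s) r)))) (κI-dc≡dcw s))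
    where
      boundary = image-boundary c j sc w
      cw = proj₁ boundary
      scw = proj₁ (proj₂ boundary)
      κI-dc≡dcw = proj₂ (proj₂ boundary)
  image-coord-cong _ w q (no _) = HH.≈H-refl {+ i} {j - q} {(λ _ → 0ℤ) , cyc-0 hatCx}

  quot-coord-cong : ∀ {x x'} → x ≈̃ x' → ∀ w s → CQ.coord w (proj₁ x) s ≡ CQ.coord w (proj₁ x') s
  quot-coord-cong (c , sc , x-x'≡dc) w s = ℤP.i-j≡0⇒i≡j _ _
    (trans (sym (LinQ.κ-- w _ _)) (trans (κQ-cong w (λ r → x-x'≡dc (tb s (resize (ht s) r)))) (complement-vanishes c j sc w s)))

  toSum-cong : ∀ ms {x x'} → x ≈̃ x' → Sum≈ ms (toSum ms x) (toSum ms x')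
  toSum-cong []       x≈x' = tt
  toSum-cong (m ∷ ms) {x} {x'} x≈x' =
    ( TensorI.map-cong m LI (λ w → Tensor.t-congˡ (image-coord-cong {x} {x'} x≈x' w (qOf m) (dI w ℤP.≟ qOf m)))
    , TensorQ.map-cong m LJ (λ w → Tensor.t-congˡ (λ s →
        trans (CQ.coordAt-val m w x s)
        (trans (cong (keep-if (dQ w ℤP.≟ qOf m)) (quot-coord-cong {x} {x'} x≈x' w s)) (sym (CQ.coordAt-val m w x' s))))) )
    , toSum-cong ms x≈x'

  ⊗-cycle : ∀ q (a : Ẑ q) (b : RB i → ℤ) → Supp (RDeg i q) b → Z̃
  ⊗-cycle q (a , sa , da≡0) b sb = a ⊗ᶠ b , supp , closed
    where
      supp : Supp (InDeg tilCx (+ i) j) (a ⊗ᶠ b)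
      supp = subst (λ j' → Supp (InDeg tilCx (+ i) j') (a ⊗ᶠ b)) ([m-n]+n≡m j q) (⊗ᶠ-supp a b sa sb)
      closed : ∀ y → d̃ (a ⊗ᶠ b) y ≡ 0ℤ
      closed (tb t r) = trans (d̃-⊗ᶠ a b (Supp⇒HatAtHeight sa) t r) (trans (cong (_* Δ̄b) (da≡0 t)) (ℤP.*-zeroˡ Δ̄b))
        where Δ̄b = sumL (allVecs i) (λ r' → Δ̄entry r' r * b r')

  -- Realising a formal sum Σ aₖ ⊗ bₖ, with each bₖ read as an element φ bₖ of R^{⊗i}, as a
  -- cycle of C̃; the last parameter says that homologous left factors give homologous cycles.
  module FromTensor (q : ℤ) (A B : Ab) (asCycle : Ab.C A → Ẑ q)
    (asCycle-⊕ : ∀ a a' s → proj₁ (asCycle (Ab._⊕_ A a a')) s ≡ proj₁ (asCycle a) s + proj₁ (asCycle a') s)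
    (asCycle-0 : ∀ s → proj₁ (asCycle (Ab.0# A)) s ≡ 0ℤ)
    (φ : Ab.C B → RB i → ℤ) (φ-supp : ∀ b → Supp (RDeg i q) (φ b))
    (φ-⊕ : ∀ b b' r → φ (Ab._⊕_ B b b') r ≡ φ b r + φ b' r)
    (φ-0 : ∀ r → φ (Ab.0# B) r ≡ 0ℤ)
    (φ-cong : ∀ {b b'} → Ab._≈_ B b b' → ∀ r → φ b r ≡ φ b' r)
    (pair-congˡ : ∀ {a a' b} → Ab._≈_ A a a' →
                  ⊗-cycle q (asCycle a) (φ b) (φ-supp b) ≈̃ ⊗-cycle q (asCycle a') (φ b) (φ-supp b))
    where
    open Tensor A B

    pair : Ab.C A → Ab.C B → Z̃
    pair a b = ⊗-cycle q (asCycle a) (φ b) (φ-supp b)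

    fromList : List (Ab.C A × Ab.C B) → Z̃
    fromList []            = 0̃
    fromList ((a , b) ∷ L) = pair a b ⊕̃ fromList L

    term : Ab.C A × Ab.C B → TilB → ℤ
    term (a , b) y = proj₁ (asCycle a) (TilB.hp y) * φ b (resize i (TilB.rl y))

    fromList-val : ∀ L y → proj₁ (fromList L) y ≡ sumL L (λ p → term p y)
    fromList-val []            y = refl
    fromList-val ((a , b) ∷ L) y = cong (_+_ (term (a , b) y)) (fromList-val L y)

    fromList-++ : ∀ L M y → proj₁ (fromList (L ++ M)) y ≡ proj₁ (fromList L) y + proj₁ (fromList M) y
    fromList-++ L M y = trans (fromList-val (L ++ M) y)
      (trans (sumL-++ L M (λ p → term p y)) (sym (cong₂ _+_ (fromList-val L y) (fromList-val M y))))

    private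
      pw : ∀ {L M} → (∀ y → proj₁ (fromList L) y ≡ proj₁ (fromList M) y) → fromList L ≈̃ fromList M
      pw {L} {M} = ≈̃-pointwise (fromList L) (fromList M)

      [a+a']b+0≡ab+[a'b+0] : ∀ a a' b → (a + a') * b + 0ℤ ≡ a * b + (a' * b + 0ℤ)
      [a+a']b+0≡ab+[a'b+0] = solve-∀
      a[b+b']+0≡ab+[ab'+0] : ∀ a b b' → a * (b + b') + 0ℤ ≡ a * b + (a * b' + 0ℤ)
      a[b+b']+0≡ab+[ab'+0] = solve-∀
      a*0+0≡0 : ∀ a → a * 0ℤ + 0ℤ ≡ 0ℤ
      a*0+0≡0 = solve-∀

    fromList-cong : ∀ {L M} → L ∼ M → fromList L ≈̃ fromList M
    fromList-cong {L} t-refl = HT.≈H-refl {x = fromList L}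
    fromList-cong {L} {M} (t-sym p) = HT.≈H-sym {x = fromList M} {fromList L} (fromList-cong p)
    fromList-cong {L} {M} (t-trans {y = N} p p') =
      HT.≈H-trans {x = fromList L} {fromList N} {fromList M} (fromList-cong p) (fromList-cong p')
    fromList-cong (t-++ {x} {x'} {y} {y'} p p') =
      HT.≈H-trans {x = fromList (x ++ y)} {fromList x ⊕̃ fromList y} {fromList (x' ++ y')}
        (≈̃-pointwise (fromList (x ++ y)) (fromList x ⊕̃ fromList y) (fromList-++ x y))
      (HT.≈H-trans {x = fromList x ⊕̃ fromList y} {fromList x' ⊕̃ fromList y'} {fromList (x' ++ y')}
        (HT.≈H-⊕ {x = fromList x} {fromList x'} {fromList y} {fromList y'} (fromList-cong p) (fromList-cong p'))
        (≈̃-pointwise (fromList x' ⊕̃ fromList y') (fromList (x' ++ y')) (λ b → sym (fromList-++ x' y' b))))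
    fromList-cong (t-swap x y) = pw {x ++ y} {y ++ x} (λ b →
      trans (fromList-++ x y b) (trans (ℤP.+-comm (proj₁ (fromList x) b) _) (sym (fromList-++ y x b))))
    fromList-cong (t-congˡ {a} {a'} {b} a≈a') =
      HT.≈H-⊕ {x = pair a b} {pair a' b} {0̃} {0̃} (pair-congˡ a≈a') (HT.≈H-refl {x = 0̃})
    fromList-cong (t-congʳ {a} {b} {b'} b≈b') = pw {(a , b) ∷ []} {(a , b') ∷ []} (λ y →
      cong (λ u → proj₁ (asCycle a) (TilB.hp y) * u + 0ℤ) (φ-cong b≈b' (resize i (TilB.rl y))))
    fromList-cong (t-linˡ a a' b) = pw {(Ab._⊕_ A a a' , b) ∷ []} {(a , b) ∷ (a' , b) ∷ []} (λ y →
      trans (cong (λ u → u * φ b (resize i (TilB.rl y)) + 0ℤ) (asCycle-⊕ a a' (TilB.hp y)))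
            ([a+a']b+0≡ab+[a'b+0] (proj₁ (asCycle a) (TilB.hp y)) (proj₁ (asCycle a') (TilB.hp y)) (φ b (resize i (TilB.rl y)))))
    fromList-cong (t-linʳ a b b') = pw {(a , Ab._⊕_ B b b') ∷ []} {(a , b) ∷ (a , b') ∷ []} (λ y →
      trans (cong (λ u → proj₁ (asCycle a) (TilB.hp y) * u + 0ℤ) (φ-⊕ b b' (resize i (TilB.rl y))))
            (a[b+b']+0≡ab+[ab'+0] (proj₁ (asCycle a) (TilB.hp y)) (φ b (resize i (TilB.rl y))) (φ b' (resize i (TilB.rl y)))))
    fromList-cong (t-zeroˡ b) = pw {(Ab.0# A , b) ∷ []} {[]} (λ y →
      trans (cong (λ u → u * φ b (resize i (TilB.rl y)) + 0ℤ) (asCycle-0 (TilB.hp y))) (ℤP.+-identityʳ _))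
    fromList-cong (t-zeroʳ a) = pw {(a , Ab.0# B) ∷ []} {[]} (λ y →
      trans (cong (λ u → proj₁ (asCycle a) (TilB.hp y) * u + 0ℤ) (φ-0 (resize i (TilB.rl y)))) (a*0+0≡0 (proj₁ (asCycle a) (TilB.hp y))))

    slice-fromList : ∀ L r s → slice i (proj₁ (fromList L)) r s ≡ sumL L (λ p → proj₁ (asCycle (proj₁ p)) s * φ (proj₂ p) r)
    slice-fromList L r s = trans (fromList-val L (tb s (resize (ht s) r))) (sumL-cong L (λ { (a , b) →
      slice-⊗ᶠ (proj₁ (asCycle a)) (φ b) (Supp⇒HatAtHeight (proj₁ (proj₂ (asCycle a)))) r s }))

    κ-fromList : ∀ {K : Set} (κ : K → (RB i → ℤ) → ℤ)
      (κ-cong : ∀ w {y y' : RB i → ℤ} → (∀ r → y r ≡ y' r) → κ w y ≡ κ w y')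
      (κ-lin : ∀ w {C : Set} (L : List C) (c : C → ℤ) (f : C → RB i → ℤ) →
               κ w (λ r → sumL L (λ p → c p * f p r)) ≡ sumL L (λ p → c p * κ w (f p)))
      L w s → κ w (λ r → slice i (proj₁ (fromList L)) r s) ≡ sumL L (λ p → κ w (φ (proj₂ p)) * proj₁ (asCycle (proj₁ p)) s)
    κ-fromList κ κ-cong κ-lin L w s =
      trans (κ-cong w (λ r → slice-fromList L r s))
      (trans (κ-lin w L (λ p → proj₁ (asCycle (proj₁ p)) s) (λ p → φ (proj₂ p)))
             (sumL-cong L (λ p → ℤP.*-comm (proj₁ (asCycle (proj₁ p)) s) (κ w (φ (proj₂ p))))))

  image-pair-congˡ : ∀ m {a a' : Ẑ (qOf m)} (b : Ab.C (ImAb i (qOf m))) → HH._≈H_ {+ i} {j - qOf m} a a' →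
    ⊗-cycle (qOf m) a (proj₁ b) (proj₁ (proj₂ b)) ≈̃ ⊗-cycle (qOf m) a' (proj₁ b) (proj₁ (proj₂ b))
  image-pair-congˡ m {a} {a'} (b , sb , b-im) (c , sc , a-a'≡dc) =
    C , subst (λ j' → Supp (InDeg tilCx (+ i - 1ℤ) j') C) ([m-n]+n≡m j (qOf m)) sC , λ y →
      trans (ab-a'b≡[a-a']b (proj₁ a (TilB.hp y)) (proj₁ a' (TilB.hp y)) (b (resize i (TilB.rl y))))
      (trans (cong (_* b (resize i (TilB.rl y))) (a-a'≡dc (TilB.hp y))) (dc⊗b≡dC (TilB.hp y) (TilB.rl y)))
    where
      lift = boundary-lift c (j - qOf m) (qOf m) b sc sb b-im
      C = proj₁ lift
      sC = proj₁ (proj₂ lift)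
      dc⊗b≡dC = proj₂ (proj₂ lift)

  quot-pair-congˡ : ∀ m {a a' : Ẑ (qOf m)} (b : Ab.C (QuotAb i (qOf m))) → (∀ s → proj₁ a s ≡ proj₁ a' s) →
    ⊗-cycle (qOf m) a (Qpart (proj₁ b)) (Qpart-supp (qOf m) (proj₁ b) (proj₂ b))
    ≈̃ ⊗-cycle (qOf m) a' (Qpart (proj₁ b)) (Qpart-supp (qOf m) (proj₁ b) (proj₂ b))
  quot-pair-congˡ m {a} {a'} (b , sb) a≡a' =
    ≈̃-pointwise (pair a) (pair a') (λ y → cong (_* Qpart b (resize i (TilB.rl y))) (a≡a' (TilB.hp y)))
    where
      pair : Ẑ (qOf m) → Z̃
      pair a = ⊗-cycle (qOf m) a (Qpart b) (Qpart-supp (qOf m) b sb)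

  module FromI (m : ℕ) = FromTensor (qOf m) (Hom hatCx (+ i) (j - qOf m)) (ImAb i (qOf m)) (λ a → a)
    (λ _ _ _ → refl) (λ _ → refl) proj₁ (λ b → proj₁ (proj₂ b)) (λ _ _ _ → refl) (λ _ → refl) (λ e → e)
    (λ {a} {a'} {b} → image-pair-congˡ m {a} {a'} b)

  module FromQ (m : ℕ) = FromTensor (qOf m) (Cyc hatCx (+ i) (j - qOf m)) (QuotAb i (qOf m)) (λ a → a)
    (λ _ _ _ → refl) (λ _ → refl) (λ b → Qpart (proj₁ b)) (λ b → Qpart-supp (qOf m) (proj₁ b) (proj₂ b))
    (λ b b' → Qpart-+ (proj₁ b) (proj₁ b')) Qpart-0 (λ {b} {b'} → Qpart-cong (proj₁ b) (proj₁ b'))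
    (λ {a} {a'} {b} → quot-pair-congˡ m {a} {a'} b)

  fromSummand : (m : ℕ) → Ab.C (Summand m) → Z̃
  fromSummand m (L1 , L2) = FromI.fromList m L1 ⊕̃ FromQ.fromList m L2

  fromSum : (ms : List ℕ) → Ab.C (⨁ ms Summand) → Z̃
  fromSum []       _          = 0̃
  fromSum (m ∷ ms) (g , rest) = fromSummand m g ⊕̃ fromSum ms rest

  fromSum-cong : ∀ ms {Y Y'} → Sum≈ ms Y Y' → fromSum ms Y ≈̃ fromSum ms Y'
  fromSum-cong []       _ = HT.≈H-refl {x = 0̃}
  fromSum-cong (m ∷ ms) {(L1 , L2) , R} {(L1' , L2') , R'} ((L1∼L1' , L2∼L2') , R≈R') =
    HT.≈H-⊕ {x = fromSummand m (L1 , L2)} {fromSummand m (L1' , L2')} {fromSum ms R} {fromSum ms R'}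
      (HT.≈H-⊕ {x = FromI.fromList m L1} {FromI.fromList m L1'} {FromQ.fromList m L2} {FromQ.fromList m L2'}
               (FromI.fromList-cong m L1∼L1') (FromQ.fromList-cong m L2∼L2'))
      (fromSum-cong ms R≈R')

  fromSummand-toSummand : ∀ m x y → proj₁ (fromSummand m (toSummand m x)) y ≡
      sumL LI (λ w → keep-if (dI w ℤP.≟ qOf m) (CI.coord w (proj₁ x) (TilB.hp y) * eI w (resize i (TilB.rl y))))
    + sumL LJ (λ w → keep-if (dQ w ℤP.≟ qOf m) (CQ.coord w (proj₁ x) (TilB.hp y) * eQ w (resize i (TilB.rl y))))
  fromSummand-toSummand m x y = cong₂ _+_
    (trans (FromI.fromList-val m (map (λ w → CI.coordAt m w x , image-basis m w) LI) y)
    (trans (sumL-map (λ w → CI.coordAt m w x , image-basis m w) LI (λ p → FromI.term m p y))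
    (sumL-cong LI (λ w → trans (cong₂ _*_ (CI.coordAt-val m w x s) (image-basis-val m w r̂)) (keep-if-* (dI w ℤP.≟ qOf m) _ _)))))
    (trans (FromQ.fromList-val m (map (λ w → CQ.coordAt m w x , quot-basis m w) LJ) y)
    (trans (sumL-map (λ w → CQ.coordAt m w x , quot-basis m w) LJ (λ p → FromQ.term m p y))
    (sumL-cong LJ (λ w → trans (cong₂ _*_ (CQ.coordAt-val m w x s) (Qpart-quot-basis m w r̂)) (keep-if-* (dQ w ℤP.≟ qOf m) _ _)))))
    where
      s = TilB.hp y
      r̂ = resize i (TilB.rl y)

  fromSum-toSum : ∀ ms x y → proj₁ (fromSum ms (toSum ms x)) y ≡ sumL ms (λ m → proj₁ (fromSummand m (toSummand m x)) y)
  fromSum-toSum []       x y = refl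
  fromSum-toSum (m ∷ ms) x y = cong (_+_ (proj₁ (fromSummand m (toSummand m x)) y)) (fromSum-toSum ms x y)

  -- Every basis vector has its degree among the summands, and in exactly one of them.
  sumL-degrees : ∀ (d : ℤ) → (Σ ℕ λ c → d ≡ - (+ c) × c ℕ.< suc (2 ℕ.* i)) →
                 ∀ a → sumL degrees (λ m → keep-if (d ℤP.≟ qOf m) a) ≡ a
  sumL-degrees d (c , d≡qc , c<2i+1) a = sumL-keep-if-∈ d a (upTo⁺ _) (∈-upTo⁺ c<2i+1) d≡qc

  fromSum-toSum-val : ∀ x y → proj₁ (fromSum degrees (toSum degrees x)) y ≡ proj₁ x y
  fromSum-toSum-val x y =
    trans (fromSum-toSum degrees x y)
    (trans (sumL-cong degrees (λ m → fromSummand-toSummand m x y))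
    (trans (sumL-+ degrees (λ m → sumL LI (λ w → keep-if (dI w ℤP.≟ qOf m) (aI w)))
                           (λ m → sumL LJ (λ w → keep-if (dQ w ℤP.≟ qOf m) (aQ w))))
    (trans (cong₂ _+_
       (trans (sumL-swap degrees LI (λ m w → keep-if (dI w ℤP.≟ qOf m) (aI w)))
              (sumL-cong LI (λ w → sumL-degrees (dI w) (dI-range w) (aI w))))
       (trans (sumL-swap degrees LJ (λ m w → keep-if (dQ w ℤP.≟ qOf m) (aQ w)))
              (sumL-cong LJ (λ w → sumL-degrees (dQ w) (dQ-range w) (aQ w)))))
    (trans (sym (expand (λ r → slice i (proj₁ x) r s) r̂)) slice-at-label))))
    where
      s = TilB.hp y
      r̂ = resize i (TilB.rl y)
      aI = λ w → CI.coord w (proj₁ x) s * eI w r̂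
      aQ = λ w → CQ.coord w (proj₁ x) s * eQ w r̂
      slice-at-label : slice i (proj₁ x) r̂ s ≡ proj₁ x y
      slice-at-label = dec-elim (ht s ℕP.≟ i)
        (λ hs≡i → cong (λ v → proj₁ x (tb s v)) (resize-resize (TilB.rl y) hs≡i))
        (λ hs≢i → trans (Supp⇒AtHeight (proj₁ (proj₂ x)) s _ hs≢i)
                        (sym (Supp⇒AtHeight (proj₁ (proj₂ x)) s (TilB.rl y) hs≢i)))

  module DegreeSelection (K : Set) (dK : K → ℤ) (T : (m : ℕ) → Ab.C (Summand m) → K → HatB → ℤ)
    (T-degree : ∀ m g w s → (dK w ≡ qOf m → ⊥) → T m g w s ≡ 0ℤ) where

    total : (ms : List ℕ) → Ab.C (⨁ ms Summand) → K → HatB → ℤ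
    total []       _          w s = 0ℤ
    total (m ∷ ms) (g , rest) w s = T m g w s + total ms rest w s

    Selects : (K → HatB → ℤ) → (ms : List ℕ) → Ab.C (⨁ ms Summand) → Set
    Selects V []       _          = ⊤
    Selects V (m ∷ ms) (g , rest) = (∀ w s → keep-if (dK w ℤP.≟ qOf m) (V w s) ≡ T m g w s) × Selects V ms rest

    VanishesOn : List ℕ → (K → HatB → ℤ) → Set
    VanishesOn ms R = All (λ m → ∀ w s → dK w ≡ qOf m → R w s ≡ 0ℤ) ms

    total-vanishes : ∀ ms Y {m} w s → All (m ≢_) ms → dK w ≡ qOf m → total ms Y w s ≡ 0ℤ
    total-vanishes []        Y          w s []              dw≡qm = refl
    total-vanishes (m' ∷ ms) (g , rest) w s (m≢m' ∷ m∉ms) dw≡qm =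
      cong₂ _+_ (T-degree m' g w s (λ dw≡qm' → m≢m' (qOf-injective (trans (sym dw≡qm) dw≡qm'))))
                (total-vanishes ms rest w s m∉ms dw≡qm)

    vanishes-shift : ∀ ms m g R → All (m ≢_) ms → VanishesOn ms R → VanishesOn ms (λ w s → T m g w s + R w s)
    vanishes-shift []        m g R []              []          = []
    vanishes-shift (m' ∷ ms) m g R (m≢m' ∷ m∉ms) (R-m' ∷ Rs) =
      (λ w s dw≡qm' → cong₂ _+_ (T-degree m g w s (λ dw≡qm → m≢m' (qOf-injective (trans (sym dw≡qm) dw≡qm'))))
                                (R-m' w s dw≡qm'))
      ∷ vanishes-shift ms m g R m∉ms Rs

    -- Each summand is peeled off in turn and absorbed into the remainder R.
    selects : ∀ V ms Y R → Unique ms → VanishesOn ms R → (∀ w s → V w s ≡ total ms Y w s + R w s) → Selects V ms Y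
    selects V []       Y          R []             []           V≡ = tt
    selects V (m ∷ ms) (g , rest) R (m∉ms ∷ uniq) (R-m ∷ Rs) V≡ =
      selected , selects V ms rest (λ w s → T m g w s + R w s) uniq (vanishes-shift ms m g R m∉ms Rs)
                   (λ w s → trans (V≡ w s) (ab+c≡b+ac (T m g w s) (total ms rest w s) (R w s)))
      where
        selected : ∀ w s → keep-if (dK w ℤP.≟ qOf m) (V w s) ≡ T m g w s
        selected w s = keep-if-elim (dK w ℤP.≟ qOf m)
          (λ dw≡qm → trans (V≡ w s)
            (trans (cong₂ (λ a b → (T m g w s + a) + b) (total-vanishes ms rest w s m∉ms dw≡qm) (R-m w s dw≡qm))
                   (trans (ℤP.+-identityʳ _) (ℤP.+-identityʳ _))))
          (λ dw≢qm → sym (T-degree m g w s dw≢qm))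

  imageTerm : (m : ℕ) → Ab.C (Summand m) → I → HatB → ℤ
  imageTerm m (L1 , L2) w s = sumL L1 (λ p → κI w (proj₁ (proj₂ p)) * proj₁ (proj₁ p) s)

  quotTerm : (m : ℕ) → Ab.C (Summand m) → J → HatB → ℤ
  quotTerm m (L1 , L2) w s = sumL L2 (λ p → κQ w (proj₁ (proj₂ p)) * proj₁ (proj₁ p) s)

  imageTerm-degree : ∀ m g w s → (dI w ≡ qOf m → ⊥) → imageTerm m g w s ≡ 0ℤ
  imageTerm-degree m (L1 , L2) w s dw≢qm = sumL-zero L1 (λ p → cong (_* proj₁ (proj₁ p) s)
    (κI-deg w (qOf m) (proj₁ (proj₂ p)) (proj₁ (proj₂ (proj₂ p))) (λ e → dw≢qm (sym e))))

  quotTerm-degree : ∀ m g w s → (dQ w ≡ qOf m → ⊥) → quotTerm m g w s ≡ 0ℤ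
  quotTerm-degree m (L1 , L2) w s dw≢qm = sumL-zero L2 (λ p → cong (_* proj₁ (proj₁ p) s)
    (κQ-deg w (qOf m) (proj₁ (proj₂ p)) (proj₂ (proj₂ p)) (λ e → dw≢qm (sym e))))

  module SelI = DegreeSelection I dI imageTerm imageTerm-degree
  module SelQ = DegreeSelection J dQ quotTerm quotTerm-degree

  coordI-fromSum : ∀ ms Y w s → CI.coord w (proj₁ (fromSum ms Y)) s ≡ SelI.total ms Y w s
  coordI-fromSum []                   Y w s = LinI.κ-zero w (λ r → refl)
  coordI-fromSum (m ∷ ms) ((L1 , L2) , rest) w s =
    trans (LinI.κ-+ w _ _)
    (cong₂ _+_ (trans (LinI.κ-+ w _ _)
                 (trans (cong₂ _+_ (FromI.κ-fromList m κI κI-cong κI-lin L1 w s) Q-part) (ℤP.+-identityʳ (imageTerm m (L1 , L2) w s))))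
               (coordI-fromSum ms rest w s))
    where
      Q-part : κI w (λ r → slice i (proj₁ (FromQ.fromList m L2)) r s) ≡ 0ℤ
      Q-part = trans (FromQ.κ-fromList m κI κI-cong κI-lin L2 w s)
        (sumL-zero L2 (λ p → cong (_* proj₁ (proj₁ p) s) (κI-Qpart w (proj₁ (proj₂ p)))))

  coordQ-fromSum : ∀ ms Y w s → CQ.coord w (proj₁ (fromSum ms Y)) s ≡ SelQ.total ms Y w s
  coordQ-fromSum []                   Y w s = LinQ.κ-zero w (λ r → refl)
  coordQ-fromSum (m ∷ ms) ((L1 , L2) , rest) w s =
    trans (LinQ.κ-+ w _ _)
    (cong₂ _+_ (trans (LinQ.κ-+ w _ _)
                 (trans (cong₂ _+_ I-part (FromQ.κ-fromList m κQ κQ-cong κQ-lin L2 w s))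
                 (trans (ℤP.+-identityˡ (sumL L2 (λ p → κQ w (Qpart (proj₁ (proj₂ p))) * proj₁ (proj₁ p) s)))
                        (sumL-cong L2 (λ p → cong (_* proj₁ (proj₁ p) s) (κQ-Qpart w (proj₁ (proj₂ p))))))))
               (coordQ-fromSum ms rest w s))
    where
      I-part : κQ w (λ r → slice i (proj₁ (FromI.fromList m L1)) r s) ≡ 0ℤ
      I-part = trans (FromI.κ-fromList m κQ κQ-cong κQ-lin L1 w s)
        (sumL-zero L1 (λ p → cong (_* proj₁ (proj₁ p) s) (κQ-im w (proj₁ (proj₂ p)) (proj₂ (proj₂ (proj₂ p))))))

  toSum-selected : ∀ x ms Y → SelI.Selects (λ w s → CI.coord w (proj₁ x) s) ms Y →
                   SelQ.Selects (λ w s → CQ.coord w (proj₁ x) s) ms Y → Sum≈ ms (toSum ms x) Y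
  toSum-selected x []       Y                   _                _                = tt
  toSum-selected x (m ∷ ms) ((L1 , L2) , rest) (selI , selIs) (selQ , selQs) =
    ( Tensor.t-sym (TensorI.normal-form m L1 (λ w → CI.coordAt m w x) (λ w s → trans (CI.coordAt-val m w x s) (selI w s)))
    , Tensor.t-sym (TensorQ.normal-form m L2 (λ w → CQ.coordAt m w x) (λ w s → trans (CQ.coordAt-val m w x s) (selQ w s))) )
    , toSum-selected x ms rest selIs selQs

  toSum-fromSum : ∀ Y → Sum≈ degrees (toSum degrees (fromSum degrees Y)) Y
  toSum-fromSum Y = toSum-selected x degrees Y
    (SelI.selects (λ w s → CI.coord w (proj₁ x) s) degrees Y (λ _ _ → 0ℤ) (upTo⁺ _) (All.universal (λ m w s _ → refl) degrees)
                  (λ w s → trans (coordI-fromSum degrees Y w s) (sym (ℤP.+-identityʳ _))))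
    (SelQ.selects (λ w s → CQ.coord w (proj₁ x) s) degrees Y (λ _ _ → 0ℤ) (upTo⁺ _) (All.universal (λ m w s _ → refl) degrees)
                  (λ w s → trans (coordQ-fromSum degrees Y w s) (sym (ℤP.+-identityʳ _))))
    where x = fromSum degrees Y

  decomposition : Hom tilCx (+ i) j ≅ ⨁ degrees Summand
  decomposition = record
    { to        = toSum degrees
    ; from      = fromSum degrees
    ; to-cong   = λ {x} {x'} → toSum-cong degrees {x} {x'}
    ; from-cong = fromSum-cong degrees
    ; to-from   = toSum-fromSum
    ; from-to   = λ x → ≈̃-pointwise (fromSum degrees (toSum degrees x)) x (fromSum-toSum-val x)
    ; to-hom    = toSum-⊕ degrees }

suppMap : ∀ {B : Set} {P Q : B → Set} {f : B → ℤ} → (∀ b → P b → Q b) → Supp P f → Supp Q f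
suppMap P⇒Q sf b = [ inj₁ , (λ p → inj₂ (P⇒Q b p)) ]′ (sf b)

module HeightShift (X : Cx) (s : ℤ) where
  open Cx X

  Shifted : Cx
  Shifted = record X { hgt = λ b → hgt b - s }

  private
    module HX = HomologyRelation X
    module HS = HomologyRelation Shifted

    down : ∀ {a} k → a ≡ k + s → a - s ≡ k
    down {a} k e = trans (cong (_- s) e) ([m+n]-n≡m k s)

    up : ∀ {a} k → a - s ≡ k → a ≡ k + s
    up {a} k e = trans (sym ([m-n]+n≡m a s)) (cong (_+ s) e)

    [k+s]-1≡[k-1]+s : ∀ k s → (k + s) - 1ℤ ≡ (k - 1ℤ) + s
    [k+s]-1≡[k-1]+s = solve-∀

  shift : ∀ i j → Hom X (i + s) j ≅ Hom Shifted i j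
  shift i j = record
    { to        = to
    ; from      = from
    ; to-cong   = λ { (c , sc , x-y≡dc) → c , suppMap (λ b (h , d) → down (i - 1ℤ) (trans h ([k+s]-1≡[k-1]+s i s)) , d) sc , x-y≡dc }
    ; from-cong = λ { (c , sc , x-y≡dc) → c , suppMap (λ b (h , d) → trans (up (i - 1ℤ) h) (sym ([k+s]-1≡[k-1]+s i s)) , d) sc , x-y≡dc }
    ; to-from   = λ y → HS.≈H-pointwise {i} {j} {to (from y)} {y} (λ b → refl)
    ; from-to   = λ x → HX.≈H-pointwise {i + s} {j} {from (to x)} {x} (λ b → refl)
    ; to-hom    = λ x y → HS.≈H-pointwise {i} {j} {to (Ab._⊕_ (Hom X (i + s) j) x y)} {Ab._⊕_ (Hom Shifted i j) (to x) (to y)} (λ b → refl) }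
    where
      to : CycCarrier X (i + s) j → CycCarrier Shifted i j
      to (f , sf , df≡0) = f , suppMap (λ b (h , d) → down i h , d) sf , df≡0
      from : CycCarrier Shifted i j → CycCarrier X (i + s) j
      from (f , sf , df≡0) = f , suppMap (λ b (h , d) → up i h , d) sf , df≡0

proposition5p3 : (F : Fatgraph) →
    ((i : ℕ) (j : ℤ) → Hom (FG.tilCx F) (+ i) j ≅ FG.RHS F i j)
    × ((i j : ℤ) → Hom (FG.tilCx F) (i + + FG.e[F] F) j ≅ Hom (FG.CCx F) i j)
proposition5p3 F = decompose , HeightShift.shift (FG.tilCx F) (+ FG.e[F] F)
  where
    open BoundaryTransfers F
    decompose : (i : ℕ) (j : ℤ) → Hom (FG.tilCx F) (+ i) j ≅ FG.RHS F i j
    decompose zero    j = Decomposition.decomposition F 0 splitBasis0 transfer0 j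
    decompose (suc k) j = Decomposition.decomposition F (suc k) (SplitBasisSuc.splitBasis k) (Suc.transfer k) j
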